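{- Fix a nonnegative integer $f$ and a positive integer $s$. There exist a function $\varepsilon_1(k)\ge0$ depending only on $f,s$ with $\varepsilon_1(k)\to0$ as $k\to\infty$, and a function $\varepsilon_2(n,k)\ge0$ (depending only on $f,s$) with $\varepsilon_2(n,k)\to0$ as $n\to\infty$ for each fixed $k$, such that the following holds. Let $n\ge k$ be positive integers, $R$ a set with $|R|=n$, and $R_1,\dots,R_f\subseteq R$ pairwise disjoint. Let $W$ be a uniformly random $k$-element subset of $R$ and $Z_i := |W\cap R_i|$ for $1\le i\le f$. Then \[ \mathbb P[Z_1=\dots=Z_f=s]\le\left(\frac{s^s}{s!e^s}\right)^f+\varepsilon_1(k)+\varepsilon_2(n,k). \] -}

module Defs where

open import Data.Bool using (Bool; true; false; _∧_)
open import Data.Nat as ℕ using (ℕ; zero; suc; _≡ᵇ_; _!)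
open import Data.Nat.Properties using (_!≢0)
open import Data.Integer using (+_)
open import Data.Fin using (Fin)
open import Data.Fin.Subset using (Subset; outside; inside; ∣_∣; _∩_; _∈_; _∉_)
open import Data.List using (List; []; _∷_; map; _++_; length; filterᵇ; allFin; foldr)
open import Data.Vec using (_∷_)
open import Data.Product using (∃-syntax; _×_)
open import Data.Rational as ℚ using (ℚ; 0ℚ; _≤_; _<_; _+_; _*_)
open import Relation.Binary.PropositionalEquality using (_≢_)

allSubsets : (n : ℕ) → List (Subset n)
allSubsets zero    = Data.Vec.[] ∷ []
allSubsets (suc n) = map (outside ∷_) (allSubsets n) ++ map (inside ∷_) (allSubsets n)

-- the k-element subsets of Fin n (sample space of a uniform random k-subset W)
kSubsets : (n k : ℕ) → List (Subset n)
kSubsets n k = filterᵇ (λ W → ∣ W ∣ ≡ᵇ k) (allSubsets n)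

event : {n f : ℕ} → (R : Fin f → Subset n) → (s : ℕ) → Subset n → Bool
event {f = f} R s W = foldr _∧_ true (map (λ i → ∣ W ∩ R i ∣ ≡ᵇ s) (allFin f))

goodCount : (n k f s : ℕ) → (R : Fin f → Subset n) → ℕ
goodCount n k f s R = length (filterᵇ (event R s) (kSubsets n k))

-- "P[event] ≤ q", i.e. goodCount / #kSubsets ≤ q, written without division
-- (the denominator n choose k is positive whenever k ≤ n)
ProbLe : (n k f s : ℕ) → (R : Fin f → Subset n) → ℚ → Set
ProbLe n k f s R q =
  (+ goodCount n k f s R) ℚ./ 1 ≤ q * ((+ length (kSubsets n k)) ℚ./ 1)

PairwiseDisjoint : {n f : ℕ} → (Fin f → Subset n) → Set
PairwiseDisjoint {n} {f} R = ∀ (i j : Fin f) → i ≢ j → ∀ (x : Fin n) → x ∈ R i → x ∉ R j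

expPartial : ℕ → ℕ → ℚ
expPartial m zero    = 0ℚ
expPartial m (suc N) = expPartial m N + ((+ (m ℕ.^ N)) ℚ./ (N !)) {{N !≢0}}

numConst : ℕ → ℕ → ℚ
numConst f s = ((+ ((s ℕ.^ s) ℕ.^ f)) ℚ./ ((s !) ℕ.^ f)) {{Data.Nat.Properties.m^n≢0 (s !) f {{s !≢0}}}}

-- ConstLt f s r  means  (s^s/(s! e^s))^f < r,
-- i.e. (s^s/s!)^f < r · e^{s f}; since the partial sums of the exponential
-- series increase to e^{sf}, this holds iff some partial sum witnesses it.
ConstLt : ℕ → ℕ → ℚ → Set
ConstLt f s r = ∃[ N ] (numConst f s < r * expPartial (s ℕ.* f) N)

NonnegNull₁ : (ℕ → ℚ) → Set
NonnegNull₁ ε = (∀ k → 0ℚ ≤ ε k)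
              × (∀ (δ : ℚ) → 0ℚ < δ → ∃[ K ] ∀ k → K ℕ.≤ k → ε k ≤ δ)

NonnegNull₂ : (ℕ → ℕ → ℚ) → Set
NonnegNull₂ ε = (∀ n k → 0ℚ ≤ ε n k)
              × (∀ k (δ : ℚ) → 0ℚ < δ → ∃[ N ] ∀ n → N ℕ.≤ n → ε n k ≤ δ)

-- Write x = fs and z = k − x.  A k-subset W with |W ∩ Rᵢ| = s for all i consists of s points
-- of each Rᵢ and z of the q = n − Σ|Rᵢ| uncovered points, so the probability is
-- C(q,z) ∏ C(|Rᵢ|,s) / C(n,k).  Bounding C(m,j) j! ≤ m^j, applying AM-GM to the values |Rᵢ|z
-- (weight s each) and qs (weight z), whose weighted sum is szn, and using
-- n^k ≤ n(n−1)⋯(n−k+1)(1 + 2k²/n) and k! ≤ z! k^x gives P ≤ (s^s/s!)^f (z/k)^z (1 + 2k²/n).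
-- Finally (z/k)^z ≤ (z/k)^k + x²/k, and (z/k)^k Σ_{j<N} x^j/j! ≤ 1 because x^j/j! is at most
-- the j-th term C(k−1+j, j)(x/k)^j of (1 − x/k)^−k.  When k ≤ x or n < 2k², one of the error
-- terms ε₁ = (s^s/s!)^f x²/k, ε₂ = (s^s/s!)^f 2k²/n is at least 1 and the bound is trivial.

module Submission where

module FiniteSums where

  import Algebra.Properties.CommutativeMonoid.Sum as MonoidSum
  open import Data.Fin using (Fin; zero; suc)
  open import Data.Fin.Properties using (suc-injective)
  open import Data.Nat using (ℕ; zero; suc; _+_; _*_; _^_; _≤_)
  open import Data.Nat.Properties
    using (+-0-commutativeMonoid; *-1-commutativeMonoid; ≤-refl; *-mono-≤; +-suc; *-distribʳ-+; *-distribˡ-+)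
  open import Function using (_∘_)
  open import Relation.Binary.PropositionalEquality

  open MonoidSum +-0-commutativeMonoid using () renaming (sum to ∑; sum-cong-≗ to ∑-cong) public
  open MonoidSum *-1-commutativeMonoid using ()
    renaming (sum to ∏; sum-cong-≗ to ∏-cong; ∑-distrib-+ to ∏-distrib-*) public

  ∑-const : ∀ m c → ∑ {m} (λ _ → c) ≡ m * c
  ∑-const zero    c = refl
  ∑-const (suc m) c = cong (c +_) (∑-const m c)

  ∏-const : ∀ m c → ∏ {m} (λ _ → c) ≡ c ^ m
  ∏-const zero    c = refl
  ∏-const (suc m) c = cong (c *_) (∏-const m c)

  ∏-mono-≤ : ∀ {m} {g h : Fin m → ℕ} → (∀ j → g j ≤ h j) → ∏ g ≤ ∏ h
  ∏-mono-≤ {zero}  g≤h = ≤-refl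
  ∏-mono-≤ {suc m} g≤h = *-mono-≤ (g≤h zero) (∏-mono-≤ (g≤h ∘ suc))

  ∑-suc-at : ∀ {m} (j : Fin m) {g h : Fin m → ℕ} →
    (∀ i → i ≢ j → g i ≡ h i) → h j ≡ suc (g j) → ∑ h ≡ suc (∑ g)
  ∑-suc-at zero    {g} {h} g≡h hj = cong₂ _+_ hj (sym (∑-cong (λ i → g≡h (suc i) λ ())))
  ∑-suc-at (suc j) {g} {h} g≡h hj = trans
    (cong₂ _+_ (sym (g≡h zero λ ())) (∑-suc-at j (λ i i≢j → g≡h (suc i) (i≢j ∘ suc-injective)) hj))
    (+-suc (g zero) _)

  ∏-+-at : ∀ {m} (j : Fin m) {g g′ h : Fin m → ℕ} →
    (∀ i → i ≢ j → g i ≡ h i) → (∀ i → i ≢ j → g′ i ≡ h i) → h j ≡ g j + g′ j →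
    ∏ h ≡ ∏ g + ∏ g′
  ∏-+-at zero {g} {g′} {h} g≡h g′≡h hj = begin
    h zero * ∏ (h ∘ suc)                                  ≡⟨ cong (_* ∏ (h ∘ suc)) hj ⟩
    (g zero + g′ zero) * ∏ (h ∘ suc)                      ≡⟨ *-distribʳ-+ _ (g zero) _ ⟩
    g zero * ∏ (h ∘ suc) + g′ zero * ∏ (h ∘ suc)          ≡⟨ cong₂ (λ a b → g zero * a + g′ zero * b)
                                                               (∏-cong (λ i → sym (g≡h (suc i) λ ())))
                                                               (∏-cong (λ i → sym (g′≡h (suc i) λ ()))) ⟩
    g zero * ∏ (g ∘ suc) + g′ zero * ∏ (g′ ∘ suc)         ∎
    where open ≡-Reasoning
  ∏-+-at (suc j) {g} {g′} {h} g≡h g′≡h hj = begin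
    h zero * ∏ (h ∘ suc)                                  ≡⟨ cong (h zero *_) (∏-+-at j (suc′ g≡h) (suc′ g′≡h) hj) ⟩
    h zero * (∏ (g ∘ suc) + ∏ (g′ ∘ suc))                 ≡⟨ *-distribˡ-+ (h zero) _ _ ⟩
    h zero * ∏ (g ∘ suc) + h zero * ∏ (g′ ∘ suc)          ≡⟨ cong₂ (λ a b → a * ∏ (g ∘ suc) + b * ∏ (g′ ∘ suc))
                                                               (sym (g≡h zero λ ())) (sym (g′≡h zero λ ())) ⟩
    g zero * ∏ (g ∘ suc) + g′ zero * ∏ (g′ ∘ suc)         ∎
    where
    open ≡-Reasoning
    suc′ : ∀ {P : Fin _ → Set} → (∀ i → i ≢ suc j → P i) → ∀ i → i ≢ j → P (suc i)
    suc′ p i i≢j = p (suc i) (i≢j ∘ suc-injective)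

module Counting where

  open import Data.Bool using (Bool; true; false; _∧_; T)
  open import Data.Bool.ListAction using (and)
  open import Data.Bool.Properties using (∧-zeroʳ)
  open import Data.Empty using (⊥-elim)
  open import Data.Fin using (Fin; zero; suc)
  open import Data.Fin.Properties using (any?; suc-injective) renaming (_≟_ to _≟ᶠ_)
  open import Data.Fin.Subset using (Subset; outside; inside; ∣_∣; _∩_; _∈_; _∉_; ⊤)
  open import Data.Fin.Subset.Properties using (_∈?_; ∣⊤∣≡n; ∩-identityˡ)
  open import Data.List using (List; []; _∷_; map; _++_; length; filterᵇ; tabulate)
  open import Data.List.Properties using (length-++; filter-++; filter-≐; filter-none; tabulate-cong; map-tabulate)
  open import Data.List.Relation.Unary.All using (universal)
  open import Data.Nat using (ℕ; zero; suc; pred; _+_; _*_; _∸_; _≤_; _≡ᵇ_; z≤n; s≤s)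
  open import Data.Nat.Combinatorics using (_C_; nCk+nC[k+1]≡[n+1]C[k+1])
  open import Data.Nat.Properties using (+-comm; +-identityʳ; *-zeroʳ; ≡ᵇ⇒≡)
  open import Data.Product using (_,_)
  open import Data.Vec using ([]; _∷_; lookup) renaming (tabulate to tabulateᵛ)
  open import Data.Vec.Functional using (updateAt) renaming (_∷_ to _◂_)
  open import Data.Vec.Functional.Properties using (updateAt-updates; updateAt-minimal)
  open import Data.Vec.Properties using (tabulate∘lookup; []=⇒lookup; lookup⇒[]=) renaming (tabulate-cong to tabulateᵛ-cong)
  open import Function using (_∘_; id)
  open import Relation.Binary.PropositionalEquality
  open import Relation.Nullary using (yes; no; does)
  open import Relation.Nullary.Decidable using (dec-true; dec-false)
  open import Relation.Nullary.Decidable.Core using (T?)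

  open import Defs
  open FiniteSums

  count : ∀ {n} → (Subset n → Bool) → ℕ
  count {n} p = length (filterᵇ p (allSubsets n))

  length-filterᵇ-map : ∀ {A B : Set} (p : B → Bool) (g : A → B) (xs : List A) →
    length (filterᵇ p (map g xs)) ≡ length (filterᵇ (p ∘ g) xs)
  length-filterᵇ-map p g [] = refl
  length-filterᵇ-map p g (x ∷ xs) with p (g x)
  ... | true  = cong suc (length-filterᵇ-map p g xs)
  ... | false = length-filterᵇ-map p g xs

  filterᵇ-filterᵇ : ∀ {A : Set} (p q : A → Bool) (xs : List A) →
    filterᵇ p (filterᵇ q xs) ≡ filterᵇ (λ x → q x ∧ p x) xs
  filterᵇ-filterᵇ p q [] = refl
  filterᵇ-filterᵇ p q (x ∷ xs) with q x
  ... | false = filterᵇ-filterᵇ p q xs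
  ... | true with p x
  ...   | true  = cong (x ∷_) (filterᵇ-filterᵇ p q xs)
  ...   | false = filterᵇ-filterᵇ p q xs

  count-suc : ∀ {n} (p : Subset (suc n) → Bool) →
    count p ≡ count (p ∘ (outside ∷_)) + count (p ∘ (inside ∷_))
  count-suc {n} p = begin
    length (filterᵇ p (map (outside ∷_) L ++ map (inside ∷_) L))
      ≡⟨ cong length (filter-++ (T? ∘ p) (map (outside ∷_) L) _) ⟩
    length (filterᵇ p (map (outside ∷_) L) ++ filterᵇ p (map (inside ∷_) L))
      ≡⟨ length-++ (filterᵇ p (map (outside ∷_) L)) ⟩
    length (filterᵇ p (map (outside ∷_) L)) + length (filterᵇ p (map (inside ∷_) L))
      ≡⟨ cong₂ _+_ (length-filterᵇ-map p _ L) (length-filterᵇ-map p _ L) ⟩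
    count (p ∘ (outside ∷_)) + count (p ∘ (inside ∷_)) ∎
    where
    open ≡-Reasoning
    L = allSubsets n

  count-cong : ∀ {n} (p q : Subset n → Bool) → (∀ W → p W ≡ q W) → count p ≡ count q
  count-cong {n} p q p≗q = cong length
    (filter-≐ (T? ∘ p) (T? ∘ q) ((λ {W} → subst T (p≗q W)) , (λ {W} → subst T (sym (p≗q W)))) (allSubsets n))

  count-none : ∀ {n} (p : Subset n → Bool) → (∀ W → p W ≡ false) → count p ≡ 0
  count-none {n} p p≗false =
    cong length (filter-none (T? ∘ p) (universal (λ W → subst T (p≗false W)) (allSubsets n)))

  count-size : ∀ n k → count {n} (λ W → ∣ W ∣ ≡ᵇ k) ≡ n C k
  count-size zero    zero    = refl
  count-size zero    (suc k) = refl
  count-size (suc n) k       = trans (count-suc {n} (λ W → ∣ W ∣ ≡ᵇ k)) (pascal k)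
    where
    pascal : ∀ k → count {n} (λ W → ∣ W ∣ ≡ᵇ k) + count {n} (λ W → suc ∣ W ∣ ≡ᵇ k) ≡ suc n C k
    pascal zero    = cong₂ _+_ (count-size n 0) (count-none {n} (λ W → suc ∣ W ∣ ≡ᵇ 0) (λ _ → refl))
    pascal (suc k) = trans (cong₂ _+_ (count-size n (suc k)) (count-size n k))
                       (trans (+-comm (n C suc k) (n C k)) (nCk+nC[k+1]≡[n+1]C[k+1] n k))

  allᶠ : ∀ {m} → (Fin m → Bool) → Bool
  allᶠ g = and (tabulate g)

  allᶠ-cong : ∀ {m} {g h : Fin m → Bool} → (∀ j → g j ≡ h j) → allᶠ g ≡ allᶠ h
  allᶠ-cong g≗h = cong and (tabulate-cong g≗h)

  allᶠ-false : ∀ {m} (g : Fin m → Bool) (j : Fin m) → g j ≡ false → allᶠ g ≡ false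
  allᶠ-false g zero    gj≡false = cong (_∧ allᶠ (g ∘ suc)) gj≡false
  allᶠ-false g (suc j) gj≡false =
    trans (cong (g zero ∧_) (allᶠ-false (g ∘ suc) j gj≡false)) (∧-zeroʳ (g zero))

  allᶠ-true : ∀ {m} (g : Fin m → Bool) → allᶠ g ≡ true → ∀ j → g j ≡ true
  allᶠ-true g all≡true j with g j in gj
  ... | true  = refl
  ... | false = sym (trans (sym all≡true) (allᶠ-false g j gj))

  fibre : ∀ {n m} → (Fin n → Fin m) → Fin m → Subset n
  fibre c j = tabulateᵛ (λ x → does (c x ≟ᶠ j))

  hasProfile : ∀ {n m} → (Fin n → Fin m) → (Fin m → ℕ) → Subset n → Bool
  hasProfile c t W = allᶠ (λ j → ∣ W ∩ fibre c j ∣ ≡ᵇ t j)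

  ∣does∷∣-≡ : ∀ {n m} (h : Fin m) (V : Subset n) → ∣ does (h ≟ᶠ h) ∷ V ∣ ≡ suc ∣ V ∣
  ∣does∷∣-≡ h V rewrite dec-true (h ≟ᶠ h) refl = refl

  ∣does∷∣-≢ : ∀ {n m} {h j : Fin m} (V : Subset n) → j ≢ h → ∣ does (h ≟ᶠ j) ∷ V ∣ ≡ ∣ V ∣
  ∣does∷∣-≢ {h = h} {j} V j≢h rewrite dec-false (h ≟ᶠ j) (j≢h ∘ sym) = refl

  count-profile-[] : ∀ {m} (t : Fin m → ℕ) →
    count {0} (λ _ → allᶠ (λ j → 0 ≡ᵇ t j)) ≡ ∏ (λ j → 0 C t j)
  count-profile-[] {zero}  t = refl
  count-profile-[] {suc m} t with t zero
  ... | zero  = trans (count-profile-[] (t ∘ suc)) (sym (+-identityʳ _))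
  ... | suc _ = refl

  module _ {n m} (c : Fin (suc n) → Fin m) (t : Fin m → ℕ) where

    private
      h  = c zero
      c′ = c ∘ suc

    hasProfile-inside-0 : t h ≡ 0 → ∀ W → hasProfile c t (inside ∷ W) ≡ false
    hasProfile-inside-0 th≡0 W = allᶠ-false _ h (cong₂ _≡ᵇ_ (∣does∷∣-≡ h (W ∩ fibre c′ h)) th≡0)

    hasProfile-inside : ∀ {t′} → t h ≡ suc t′ → ∀ W → hasProfile c t (inside ∷ W) ≡ hasProfile c′ (updateAt t h pred) W
    hasProfile-inside {t′} th≡1+t′ W = allᶠ-cong pointwise
      where
      pointwise : ∀ j → (∣ (inside ∷ W) ∩ fibre c j ∣ ≡ᵇ t j) ≡ (∣ W ∩ fibre c′ j ∣ ≡ᵇ updateAt t h pred j)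
      pointwise j with j ≟ᶠ h
      ... | yes refl = cong₂ _≡ᵇ_ (∣does∷∣-≡ h (W ∩ fibre c′ h))
                         (trans th≡1+t′ (cong suc (sym (trans (updateAt-updates h t) (cong pred th≡1+t′)))))
      ... | no j≢h   = cong₂ _≡ᵇ_ (∣does∷∣-≢ (W ∩ fibre c′ j) j≢h) (sym (updateAt-minimal j h t j≢h))

    ∏C-fibre-0 : t h ≡ 0 → ∏ (λ j → ∣ fibre c j ∣ C t j) ≡ ∏ (λ j → ∣ fibre c′ j ∣ C t j)
    ∏C-fibre-0 th≡0 = ∏-cong pointwise
      where
      pointwise : ∀ j → ∣ fibre c j ∣ C t j ≡ ∣ fibre c′ j ∣ C t j
      pointwise j with j ≟ᶠ h
      ... | yes refl rewrite th≡0 = refl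
      ... | no j≢h = cong (_C t j) (∣does∷∣-≢ (fibre c′ j) j≢h)

    ∏C-fibre-pascal : ∀ {t′} → t h ≡ suc t′ →
      ∏ (λ j → ∣ fibre c j ∣ C t j) ≡ ∏ (λ j → ∣ fibre c′ j ∣ C t j) + ∏ (λ j → ∣ fibre c′ j ∣ C updateAt t h pred j)
    ∏C-fibre-pascal {t′} th≡1+t′ = ∏-+-at h
      (λ j j≢h → cong (_C t j) (sym (∣does∷∣-≢ (fibre c′ j) j≢h)))
      (λ j j≢h → cong₂ _C_ (sym (∣does∷∣-≢ (fibre c′ j) j≢h)) (updateAt-minimal j h t j≢h))
      (begin
        ∣ fibre c h ∣ C t h                            ≡⟨ cong₂ _C_ (∣does∷∣-≡ h (fibre c′ h)) th≡1+t′ ⟩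
        suc a C suc t′                                 ≡⟨ sym (nCk+nC[k+1]≡[n+1]C[k+1] a t′) ⟩
        a C t′ + a C suc t′                            ≡⟨ +-comm (a C t′) (a C suc t′) ⟩
        a C suc t′ + a C t′                            ≡⟨ cong₂ (λ u v → a C u + a C v) (sym th≡1+t′)
                                                            (sym (trans (updateAt-updates h t) (cong pred th≡1+t′))) ⟩
        a C t h + a C updateAt t h pred h              ∎)
      where
      open ≡-Reasoning
      a = ∣ fibre c′ h ∣

  count-profile : ∀ n {m} (c : Fin n → Fin m) (t : Fin m → ℕ) →
    count (hasProfile c t) ≡ ∏ (λ j → ∣ fibre c j ∣ C t j)
  count-profile zero    c t = trans (count-cong (hasProfile c t) (λ _ → allᶠ (λ j → 0 ≡ᵇ t j)) λ { [] → refl }) (count-profile-[] t)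
  count-profile (suc n) c t with t (c zero) in th
  ... | zero   = begin
    count (hasProfile c t)                                           ≡⟨ count-suc {n} (hasProfile c t) ⟩
    count (hasProfile c′ t) + count (hasProfile c t ∘ (inside ∷_))   ≡⟨ cong₂ _+_ (count-profile n c′ t)
                                                                          (count-none (hasProfile c t ∘ (inside ∷_)) (hasProfile-inside-0 c t th)) ⟩
    ∏ (λ j → ∣ fibre c′ j ∣ C t j) + 0                               ≡⟨ +-identityʳ _ ⟩
    ∏ (λ j → ∣ fibre c′ j ∣ C t j)                                   ≡⟨ sym (∏C-fibre-0 c t th) ⟩
    ∏ (λ j → ∣ fibre c j ∣ C t j)                                    ∎
    where
    open ≡-Reasoning
    c′ = c ∘ suc
  ... | suc _  = begin
    count (hasProfile c t)                                           ≡⟨ count-suc {n} (hasProfile c t) ⟩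
    count (hasProfile c′ t) + count (hasProfile c t ∘ (inside ∷_))   ≡⟨ cong₂ _+_ (count-profile n c′ t)
                                                                          (trans (count-cong _ (hasProfile c′ t⁻) (hasProfile-inside c t th))
                                                                                 (count-profile n c′ t⁻)) ⟩
    ∏ (λ j → ∣ fibre c′ j ∣ C t j) + ∏ (λ j → ∣ fibre c′ j ∣ C t⁻ j) ≡⟨ sym (∏C-fibre-pascal c t th) ⟩
    ∏ (λ j → ∣ fibre c j ∣ C t j)                                    ∎
    where
    open ≡-Reasoning
    c′ = c ∘ suc
    t⁻ = updateAt t (c zero) pred

  ∣∣≡∑∣∩fibre∣ : ∀ {n m} (c : Fin n → Fin m) (W : Subset n) → ∣ W ∣ ≡ ∑ (λ j → ∣ W ∩ fibre c j ∣)
  ∣∣≡∑∣∩fibre∣ {m = m} c []            = sym (trans (∑-const m 0) (*-zeroʳ m))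
  ∣∣≡∑∣∩fibre∣         c (outside ∷ W) = ∣∣≡∑∣∩fibre∣ (c ∘ suc) W
  ∣∣≡∑∣∩fibre∣         c (inside ∷ W)  = trans (cong suc (∣∣≡∑∣∩fibre∣ (c ∘ suc) W)) (sym (∑-suc-at (c zero)
    (λ j j≢h → sym (∣does∷∣-≢ (W ∩ fibre (c ∘ suc) j) j≢h)) (∣does∷∣-≡ (c zero) (W ∩ fibre (c ∘ suc) (c zero)))))

  n≡∑∣fibre∣ : ∀ {n m} (c : Fin n → Fin m) → n ≡ ∑ (λ j → ∣ fibre c j ∣)
  n≡∑∣fibre∣ {n} c = trans (sym (∣⊤∣≡n n))
    (trans (∣∣≡∑∣∩fibre∣ c ⊤) (∑-cong (λ j → cong ∣_∣ (∩-identityˡ (fibre c j)))))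

  -- A disjoint family becomes a colouring: R i gets colour suc i, the uncovered points colour zero.
  colour : ∀ {n f} → (Fin f → Subset n) → Fin n → Fin (suc f)
  colour R x with any? (λ i → x ∈? R i)
  ... | yes (i , _) = suc i
  ... | no  _       = zero

  lookup-∉ : ∀ {n} {x : Fin n} (V : Subset n) → x ∉ V → lookup V x ≡ false
  lookup-∉ {x = x} V x∉V with lookup V x in eq
  ... | true  = ⊥-elim (x∉V (lookup⇒[]= x V eq))
  ... | false = refl

  fibre-colour : ∀ {n f} (R : Fin f → Subset n) → PairwiseDisjoint R → ∀ i → fibre (colour R) (suc i) ≡ R i
  fibre-colour R disjoint i = trans (tabulateᵛ-cong pointwise) (tabulate∘lookup (R i))
    where
    same : ∀ {x} j → x ∈ R j → x ∈ R i → suc j ≡ suc i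
    same j x∈Rj x∈Ri with j ≟ᶠ i
    ... | yes j≡i = cong suc j≡i
    ... | no  j≢i = ⊥-elim (disjoint j i j≢i _ x∈Rj x∈Ri)
    pointwise : ∀ x → does (colour R x ≟ᶠ suc i) ≡ lookup (R i) x
    pointwise x with any? (λ i → x ∈? R i) | x ∈? R i
    ... | yes (j , x∈Rj) | yes x∈Ri = trans (dec-true (suc j ≟ᶠ suc i) (same j x∈Rj x∈Ri)) (sym ([]=⇒lookup x∈Ri))
    ... | yes (j , x∈Rj) | no  x∉Ri = trans (dec-false (suc j ≟ᶠ suc i)
                                         (λ e → x∉Ri (subst (λ k → x ∈ R k) (suc-injective e) x∈Rj)))
                                       (sym (lookup-∉ (R i) x∉Ri))
    ... | no  none       | yes x∈Ri = ⊥-elim (none (i , x∈Ri))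
    ... | no  _          | no  x∉Ri = sym (lookup-∉ (R i) x∉Ri)

  +-≡ᵇ-∸ : ∀ a b k → b ≤ k → (b + a ≡ᵇ k) ≡ (a ≡ᵇ k ∸ b)
  +-≡ᵇ-∸ a zero    k       z≤n       = refl
  +-≡ᵇ-∸ a (suc b) (suc k) (s≤s b≤k) = +-≡ᵇ-∸ a b k b≤k

  event≡allᶠ : ∀ {n f} (R : Fin f → Subset n) s W → event R s W ≡ allᶠ (λ i → ∣ W ∩ R i ∣ ≡ᵇ s)
  event≡allᶠ R s W = cong and (map-tabulate id (λ i → ∣ W ∩ R i ∣ ≡ᵇ s))

  goodCount≡ : ∀ {n k f s} (R : Fin f → Subset n) → PairwiseDisjoint R → f * s ≤ k →
    goodCount n k f s R ≡ (∣ fibre (colour R) zero ∣ C (k ∸ f * s)) * ∏ (λ i → ∣ R i ∣ C s)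
  goodCount≡ {n} {k} {f} {s} R disjoint fs≤k = begin
    goodCount n k f s R
      ≡⟨ cong length (filterᵇ-filterᵇ (event R s) (λ W → ∣ W ∣ ≡ᵇ k) (allSubsets n)) ⟩
    count (λ W → (∣ W ∣ ≡ᵇ k) ∧ event R s W)
      ≡⟨ count-cong _ (hasProfile c t) pointwise ⟩
    count (hasProfile c t)
      ≡⟨ count-profile n c t ⟩
    (∣ fibre c zero ∣ C (k ∸ f * s)) * ∏ (λ i → ∣ fibre c (suc i) ∣ C s)
      ≡⟨ cong ((∣ fibre c zero ∣ C (k ∸ f * s)) *_) (∏-cong (λ i → cong (_C s) (cong ∣_∣ (fibre-colour R disjoint i)))) ⟩
    (∣ fibre c zero ∣ C (k ∸ f * s)) * ∏ (λ i → ∣ R i ∣ C s) ∎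
    where
    open ≡-Reasoning
    c = colour R
    t = (k ∸ f * s) ◂ (λ _ → s)
    pointwise : ∀ W → ((∣ W ∣ ≡ᵇ k) ∧ event R s W) ≡ hasProfile c t W
    pointwise W rewrite event≡allᶠ R s W
                      | allᶠ-cong (λ i → cong (λ V → ∣ W ∩ V ∣ ≡ᵇ s) (sym (fibre-colour R disjoint i)))
      with allᶠ (λ i → ∣ W ∩ fibre c (suc i) ∣ ≡ᵇ s) in all-s
    ... | false = trans (∧-zeroʳ _) (sym (∧-zeroʳ _))
    ... | true  = cong (_∧ true) (begin
      ∣ W ∣ ≡ᵇ k
        ≡⟨ cong (_≡ᵇ k) (∣∣≡∑∣∩fibre∣ c W) ⟩
      ∣ W ∩ fibre c zero ∣ + ∑ (λ i → ∣ W ∩ fibre c (suc i) ∣) ≡ᵇ k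
        ≡⟨ cong (λ x → ∣ W ∩ fibre c zero ∣ + x ≡ᵇ k)
             (trans (∑-cong (λ i → ≡ᵇ⇒≡ ∣ W ∩ fibre c (suc i) ∣ s (subst T (sym (allᶠ-true _ all-s i)) _))) (∑-const f s)) ⟩
      ∣ W ∩ fibre c zero ∣ + f * s ≡ᵇ k
        ≡⟨ cong (_≡ᵇ k) (+-comm _ (f * s)) ⟩
      f * s + ∣ W ∩ fibre c zero ∣ ≡ᵇ k
        ≡⟨ +-≡ᵇ-∸ _ (f * s) k fs≤k ⟩
      ∣ W ∩ fibre c zero ∣ ≡ᵇ k ∸ f * s ∎)

module Inequalities where

  open import Data.Fin using (Fin; zero; suc)
  open import Data.Nat using (ℕ; zero; suc; _+_; _*_; _∸_; _^_; _≤_; _<_; z≤n; s≤s; _!; >-nonZero)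
  open import Data.Nat.Combinatorics using (_C_; _P_; nCk≡nPk/k!; nPk≡n!/[n∸k]!; k>n⇒nCk≡0)
  open import Data.Nat.Combinatorics.Base using (_P′_)
  open import Data.Nat.Combinatorics.Specification using (nP′k≡n!/[n∸k]!; k!∣nP′k)
  open import Data.Nat.DivMod using (_/_; m/n*n≡m)
  open import Data.Nat.Properties
  open import Data.Nat.Solver using (module +-*-Solver)
  open import Data.Sum using (inj₁; inj₂)
  open import Data.Vec.Functional using () renaming (_∷_ to _◂_)
  open import Function using (_∘_)
  open import Relation.Binary.PropositionalEquality
  open import Relation.Nullary using (yes; no)

  open import Algebra.Properties.Semiring.Sum +-*-semiring using (*-distribˡ-sum)
  open +-*-Solver
  open FiniteSums

  ^-distribʳ-* : ∀ m n o → (m * n) ^ o ≡ m ^ o * n ^ o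
  ^-distribʳ-* m n zero    = refl
  ^-distribʳ-* m n (suc o) = trans (cong (m * n *_) (^-distribʳ-* m n o))
    (solve 4 (λ m n a b → (m :* n) :* (a :* b) := (m :* a) :* (n :* b)) refl m n (m ^ o) (n ^ o))

  nP′k≤n^k : ∀ n k → n P′ k ≤ n ^ k
  nP′k≤n^k n zero    = ≤-refl
  nP′k≤n^k n (suc k) = *-mono-≤ (m∸n≤m n k) (nP′k≤n^k n k)

  [1+r]^j≤nP′j : ∀ {r j n} → r + j ≤ n → suc r ^ j ≤ n P′ j
  [1+r]^j≤nP′j {j = zero}          _     = ≤-refl
  [1+r]^j≤nP′j {r} {suc j} {n} r+j<n = *-mono-≤
    (subst (_≤ n ∸ j) (m+n∸n≡m (suc r) j) (∸-monoˡ-≤ j (subst (_≤ n) (+-suc r j) r+j<n)))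
    ([1+r]^j≤nP′j {r} {j} (≤-trans (n≤1+n _) (subst (_≤ n) (+-suc r j) r+j<n)))

  nCk*k!≡nP′k : ∀ {n k} → k ≤ n → (n C k) * k ! ≡ n P′ k
  nCk*k!≡nP′k {n} {k} k≤n = begin
    (n C k) * k !                ≡⟨ cong (_* k !) (nCk≡nPk/k! k≤n) ⟩
    ((n P k) / k !) * k !        ≡⟨ cong (λ p → p / k ! * k !) nPk≡nP′k ⟩
    ((n P′ k) / k !) * k !       ≡⟨ m/n*n≡m (k!∣nP′k k≤n) ⟩
    n P′ k                       ∎
    where
    open ≡-Reasoning
    instance _ = k !≢0
    instance _ = (n ∸ k) !≢0
    nPk≡nP′k : n P k ≡ n P′ k
    nPk≡nP′k = trans (nPk≡n!/[n∸k]! k≤n) (sym (nP′k≡n!/[n∸k]! k≤n))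

  nCk*k!≤n^k : ∀ n k → (n C k) * k ! ≤ n ^ k
  nCk*k!≤n^k n k with k ≤? n
  ... | yes k≤n = ≤-trans (≤-reflexive (nCk*k!≡nP′k k≤n)) (nP′k≤n^k n k)
  ... | no  k≰n = subst (_≤ n ^ k) (sym (cong (_* k !) (k>n⇒nCk≡0 (≰⇒> k≰n)))) z≤n

  [1+r]^j≤j!*[r+j]Cj : ∀ r j → suc r ^ j ≤ j ! * ((r + j) C j)
  [1+r]^j≤j!*[r+j]Cj r j = ≤-trans ([1+r]^j≤nP′j {r} {j} ≤-refl)
    (≤-reflexive (trans (sym (nCk*k!≡nP′k (m≤n+m j r))) (*-comm _ (j !))))

  [m+n]!≤n!*[m+n]^m : ∀ m n → (m + n) ! ≤ n ! * (m + n) ^ m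
  [m+n]!≤n!*[m+n]^m zero    n = ≤-reflexive (sym (*-identityʳ (n !)))
  [m+n]!≤n!*[m+n]^m (suc m) n = begin
    suc (m + n) * (m + n) !                      ≤⟨ *-monoʳ-≤ (suc (m + n)) ([m+n]!≤n!*[m+n]^m m n) ⟩
    suc (m + n) * (n ! * (m + n) ^ m)            ≤⟨ *-monoʳ-≤ (suc (m + n)) (*-monoʳ-≤ (n !) (^-monoˡ-≤ m (n≤1+n _))) ⟩
    suc (m + n) * (n ! * suc (m + n) ^ m)        ≡⟨ solve 3 (λ a b c → a :* (b :* c) := b :* (a :* c)) refl
                                                      (suc (m + n)) (n !) (suc (m + n) ^ m) ⟩
    n ! * (suc (m + n) * suc (m + n) ^ m)        ∎
    where open ≤-Reasoning

  n^k*n≤nP′k*n+k*k*n^k : ∀ n k → n ^ k * n ≤ (n P′ k) * n + k * k * n ^ k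
  n^k*n≤nP′k*n+k*k*n^k n zero    = m≤m+n (1 * n) 0
  n^k*n≤nP′k*n+k*k*n^k n (suc k) = begin
    n * nᵏ * n                                     ≡⟨ *-assoc n nᵏ n ⟩
    n * (nᵏ * n)                                   ≤⟨ *-monoʳ-≤ n (n^k*n≤nP′k*n+k*k*n^k n k) ⟩
    n * (Pₖ * n + k * k * nᵏ)                       ≤⟨ *-monoʳ-≤ n (+-monoˡ-≤ (k * k * nᵏ) (*-monoʳ-≤ Pₖ (m≤n+m∸n n k))) ⟩
    n * (Pₖ * (k + (n ∸ k)) + k * k * nᵏ)           ≤⟨ *-monoʳ-≤ n (+-monoˡ-≤ (k * k * nᵏ) (≤-reflexive
                                                        (trans (*-distribˡ-+ Pₖ k (n ∸ k)) (+-comm (Pₖ * k) _)))) ⟩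
    n * (Pₖ * (n ∸ k) + Pₖ * k + k * k * nᵏ)         ≤⟨ *-monoʳ-≤ n (+-monoˡ-≤ (k * k * nᵏ)
                                                        (+-monoʳ-≤ (Pₖ * (n ∸ k)) (*-monoˡ-≤ k (nP′k≤n^k n k)))) ⟩
    n * (Pₖ * (n ∸ k) + nᵏ * k + k * k * nᵏ)        ≡⟨ solve 5 (λ n Pₖ d nᵏ k → n :* (Pₖ :* d :+ nᵏ :* k :+ k :* k :* nᵏ)
                                                        := d :* Pₖ :* n :+ (k :+ k :* k) :* (n :* nᵏ)) refl n Pₖ (n ∸ k) nᵏ k ⟩
    (n ∸ k) * Pₖ * n + (k + k * k) * (n * nᵏ)       ≤⟨ +-monoʳ-≤ ((n ∸ k) * Pₖ * n) (*-monoˡ-≤ (n * nᵏ) k+k²≤[1+k]²) ⟩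
    (n ∸ k) * Pₖ * n + suc k * suc k * (n * nᵏ)     ∎
    where
    open ≤-Reasoning
    nᵏ = n ^ k
    Pₖ  = n P′ k
    k+k²≤[1+k]² : k + k * k ≤ suc k * suc k
    k+k²≤[1+k]² = ≤-trans (m≤n+m (k + k * k) (suc k))
      (≤-reflexive (solve 1 (λ k → (con 1 :+ k) :+ (k :+ k :* k) := (con 1 :+ k) :* (con 1 :+ k)) refl k))

  n*n^k≤nP′k*[n+2k²] : ∀ n k → 0 < n → 2 * k * k ≤ n → n * n ^ k ≤ (n P′ k) * (n + 2 * k * k)
  n*n^k≤nP′k*[n+2k²] n k 0<n 2k²≤n = begin
    n * nᵏ                           ≡⟨ *-comm n nᵏ ⟩
    nᵏ * n                           ≤⟨ n^k*n≤nP′k*n+k*k*n^k n k ⟩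
    Pₖ * n + k * k * nᵏ               ≤⟨ +-monoʳ-≤ (Pₖ * n) (*-monoʳ-≤ (k * k) nᵏ≤2P) ⟩
    Pₖ * n + k * k * (2 * Pₖ)          ≡⟨ solve 3 (λ Pₖ n k → Pₖ :* n :+ k :* k :* (con 2 :* Pₖ) := Pₖ :* (n :+ con 2 :* k :* k)) refl Pₖ n k ⟩
    Pₖ * (n + 2 * k * k)              ∎
    where
    open ≤-Reasoning
    nᵏ = n ^ k
    Pₖ  = n P′ k
    nᵏ≤2P : nᵏ ≤ 2 * Pₖ
    nᵏ≤2P = *-cancelʳ-≤ nᵏ (2 * Pₖ) n {{>-nonZero 0<n}} (+-cancelʳ-≤ (nᵏ * n) _ _ (begin
      nᵏ * n + nᵏ * n                ≡⟨ solve 2 (λ a n → a :* n :+ a :* n := con 2 :* (a :* n)) refl nᵏ n ⟩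
      2 * (nᵏ * n)                   ≤⟨ *-monoʳ-≤ 2 (n^k*n≤nP′k*n+k*k*n^k n k) ⟩
      2 * (Pₖ * n + k * k * nᵏ)       ≡⟨ solve 4 (λ Pₖ n k a → con 2 :* (Pₖ :* n :+ k :* k :* a) := con 2 :* Pₖ :* n :+ con 2 :* k :* k :* a)
                                          refl Pₖ n k nᵏ ⟩
      2 * Pₖ * n + 2 * k * k * nᵏ     ≤⟨ +-monoʳ-≤ (2 * Pₖ * n) (*-monoˡ-≤ nᵏ 2k²≤n) ⟩
      2 * Pₖ * n + n * nᵏ             ≡⟨ cong (2 * Pₖ * n +_) (*-comm n nᵏ) ⟩
      2 * Pₖ * n + nᵏ * n             ∎))

  ∏C*k!^f≤∏^ : ∀ {f} (m : Fin f → ℕ) k → ∏ (λ i → m i C k) * (k !) ^ f ≤ ∏ (λ i → m i ^ k)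
  ∏C*k!^f≤∏^ {f} m k = begin
    ∏ (λ i → m i C k) * (k !) ^ f                  ≡⟨ cong (∏ (λ i → m i C k) *_) (sym (∏-const f (k !))) ⟩
    ∏ (λ i → m i C k) * ∏ {f} (λ _ → k !)          ≡⟨ sym (∏-distrib-* (λ i → m i C k) (λ _ → k !)) ⟩
    ∏ (λ i → (m i C k) * k !)                      ≤⟨ ∏-mono-≤ (λ i → nCk*k!≤n^k (m i) k) ⟩
    ∏ (λ i → m i ^ k)                              ∎
    where open ≤-Reasoning

  2*m*n≤m*m+n*n : ∀ m n → 2 * m * n ≤ m * m + n * n
  2*m*n≤m*m+n*n m n with ≤-total m n
  ... | inj₁ m≤n = subst (λ n → 2 * m * n ≤ m * m + n * n) (m+[n∸m]≡n m≤n) (square-gap m (n ∸ m))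
    where
    square-gap : ∀ a d → 2 * a * (a + d) ≤ a * a + (a + d) * (a + d)
    square-gap a d = subst (2 * a * (a + d) ≤_)
      (solve 2 (λ a d → con 2 :* a :* (a :+ d) :+ d :* d := a :* a :+ (a :+ d) :* (a :+ d)) refl a d) (m≤m+n _ _)
  ... | inj₂ n≤m = subst (λ m → 2 * m * n ≤ m * m + n * n) (m+[n∸m]≡n n≤m) (square-gap n (m ∸ n))
    where
    square-gap : ∀ b d → 2 * (b + d) * b ≤ (b + d) * (b + d) + b * b
    square-gap b d = subst (2 * (b + d) * b ≤_)
      (solve 2 (λ b d → con 2 :* (b :+ d) :* b :+ d :* d := (b :+ d) :* (b :+ d) :+ b :* b) refl b d) (m≤m+n _ _)

  young : ∀ n a b → suc n * a * b ^ n ≤ a ^ suc n + n * b ^ suc n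
  young zero    a b = ≤-reflexive (solve 2 (λ a b → con 1 :* a :* con 1 := a :* con 1 :+ con 0 :* (b :* con 1)) refl a b)
  young (suc n) a b = +-cancelʳ-≤ (n * a * b * bⁿ) _ _ (begin
    suc (suc n) * a * (b * bⁿ) + n * a * b * bⁿ        ≡⟨ solve 4 (λ n a b c → (con 2 :+ n) :* a :* (b :* c) :+ n :* a :* b :* c
                                                            := (con 1 :+ n) :* c :* (con 2 :* a :* b)) refl n a b bⁿ ⟩
    suc n * bⁿ * (2 * a * b)                            ≤⟨ *-monoʳ-≤ (suc n * bⁿ) (2*m*n≤m*m+n*n a b) ⟩
    suc n * bⁿ * (a * a + b * b)                        ≡⟨ solve 4 (λ n a b c → (con 1 :+ n) :* c :* (a :* a :+ b :* b)
                                                            := a :* ((con 1 :+ n) :* a :* c) :+ (con 1 :+ n) :* (b :* (b :* c))) refl n a b bⁿ ⟩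
    a * (suc n * a * bⁿ) + suc n * (b * (b * bⁿ))       ≤⟨ +-monoˡ-≤ (suc n * (b * (b * bⁿ))) (*-monoʳ-≤ a (young n a b)) ⟩
    a * (a ^ suc n + n * (b * bⁿ)) + suc n * (b * (b * bⁿ))
                                                        ≡⟨ solve 5 (λ n a b c d → a :* (d :+ n :* (b :* c)) :+ (con 1 :+ n) :* (b :* (b :* c))
                                                            := a :* d :+ (con 1 :+ n) :* (b :* (b :* c)) :+ n :* a :* b :* c) refl n a b bⁿ (a ^ suc n) ⟩
    a * a ^ suc n + suc n * (b * (b * bⁿ)) + n * a * b * bⁿ ∎)
    where
    open ≤-Reasoning
    bⁿ = b ^ n

  k^k>0 : ∀ k → 0 < k ^ k
  k^k>0 zero    = s≤s z≤n
  k^k>0 (suc k) = m^n>0 (suc k) (suc k)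

  am-gm-step : ∀ k x s → suc k ^ suc k * x * s ^ k ≤ k ^ k * (x + s) ^ suc k
  am-gm-step zero    x s = ≤-trans (≤-reflexive (solve 1 (λ x → (con 1 :* con 1) :* x :* con 1 := x) refl x))
    (≤-trans (m≤m+n x s) (≤-reflexive (solve 2 (λ x s → x :+ s := con 1 :* ((x :+ s) :* con 1)) refl x s)))
  am-gm-step (suc k′) x s = *-cancelˡ-≤ k (+-cancelʳ-≤ (k * (k₁ᵏ⁺¹ * s * sᵏ)) _ _ (begin
    k * (k₁ᵏ⁺¹ * x * sᵏ) + k * (k₁ᵏ⁺¹ * s * sᵏ)       ≡⟨ solve 5 (λ k a x s c → k :* ((con 1 :+ k) :* a :* x :* c) :+ k :* ((con 1 :+ k) :* a :* s :* c)
                                                           := (con 1 :+ k) :* (k :* (x :+ s)) :* (a :* c)) refl k k₁ᵏ x s sᵏ ⟩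
    suc k * (k * (x + s)) * (k₁ᵏ * sᵏ)                ≡⟨ cong (suc k * (k * (x + s)) *_) (sym (^-distribʳ-* (suc k) s k)) ⟩
    suc k * (k * (x + s)) * (suc k * s) ^ k           ≤⟨ young k (k * (x + s)) (suc k * s) ⟩
    (k * (x + s)) ^ suc k + k * (suc k * s) ^ suc k   ≡⟨ cong₂ (λ u v → u + k * v) (^-distribʳ-* k (x + s) (suc k)) (^-distribʳ-* (suc k) s (suc k)) ⟩
    k ^ suc k * q + k * (suc k ^ suc k * s ^ suc k)   ≡⟨ solve 6 (λ k kᵏ q a s c → (k :* kᵏ) :* q :+ k :* (((con 1 :+ k) :* a) :* (s :* c))
                                                           := k :* (kᵏ :* q) :+ k :* ((con 1 :+ k) :* a :* s :* c)) refl k (k ^ k) q k₁ᵏ s sᵏ ⟩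
    k * (k ^ k * q) + k * (k₁ᵏ⁺¹ * s * sᵏ)            ∎))
    where
    open ≤-Reasoning
    k = suc k′
    sᵏ = s ^ k
    q = (x + s) ^ suc k
    k₁ᵏ = suc k ^ k
    k₁ᵏ⁺¹ = suc k * k₁ᵏ

  am-gm-cons : ∀ {k s p} x → k ^ k * p ≤ s ^ k → suc k ^ suc k * (x * p) ≤ (x + s) ^ suc k
  am-gm-cons {k} {s} {p} x kᵏp≤sᵏ = *-cancelˡ-≤ (k ^ k) {{>-nonZero (k^k>0 k)}} (begin
    k ^ k * (suc k ^ suc k * (x * p))     ≡⟨ solve 4 (λ a b x p → a :* (b :* (x :* p)) := b :* x :* (a :* p)) refl (k ^ k) (suc k ^ suc k) x p ⟩
    suc k ^ suc k * x * (k ^ k * p)       ≤⟨ *-monoʳ-≤ (suc k ^ suc k * x) kᵏp≤sᵏ ⟩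
    suc k ^ suc k * x * s ^ k             ≤⟨ am-gm-step k x s ⟩
    k ^ k * (x + s) ^ suc k               ∎)
    where open ≤-Reasoning

  am-gm-replicate : ∀ {k s p} c x → k ^ k * p ≤ s ^ k → (c + k) ^ (c + k) * (x ^ c * p) ≤ (c * x + s) ^ (c + k)
  am-gm-replicate {k} {s} {p} zero    x kᵏp≤sᵏ = subst (λ p′ → k ^ k * p′ ≤ s ^ k) (sym (+-identityʳ p)) kᵏp≤sᵏ
  am-gm-replicate {k} {s} {p} (suc c) x kᵏp≤sᵏ = subst₂ (λ a b → suc (c + k) ^ suc (c + k) * a ≤ b ^ suc (c + k))
    (sym (*-assoc x (x ^ c) p)) (sym (+-assoc x (c * x) s))
    (am-gm-cons {c + k} {c * x + s} {x ^ c * p} x (am-gm-replicate {k} {s} {p} c x kᵏp≤sᵏ))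

  am-gm : ∀ {l} (w a : Fin l → ℕ) → ∑ w ^ ∑ w * ∏ (λ j → a j ^ w j) ≤ ∑ (λ j → w j * a j) ^ ∑ w
  am-gm {zero}  w a = ≤-refl
  am-gm {suc l} w a = am-gm-replicate (w zero) (a zero) (am-gm (w ∘ suc) (a ∘ suc))

  am-gm-profile : ∀ {f} (q : ℕ) (m : Fin f → ℕ) {s z} → 0 < s → 0 < z →
    (f * s + z) ^ (f * s + z) * (q ^ z * ∏ (λ i → m i ^ s)) ≤ (s ^ s) ^ f * z ^ z * (q + ∑ m) ^ (f * s + z)
  am-gm-profile {f} q m {s} {z} 0<s 0<z = *-cancelʳ-≤ _ _ c {{>-nonZero 0<c}} (begin
    K ^ K * (q ^ z * mˢ) * c                  ≡⟨ trans (*-assoc (K ^ K) _ c) (cong (K ^ K *_) product≡) ⟩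
    K ^ K * ∏ (λ j → a j ^ w j)               ≡⟨ cong (λ e → e ^ e * ∏ (λ j → a j ^ w j)) ∑w≡K ⟨
    ∑ w ^ ∑ w * ∏ (λ j → a j ^ w j)           ≤⟨ am-gm w a ⟩
    ∑ (λ j → w j * a j) ^ ∑ w                 ≡⟨ cong₂ _^_ sum≡ ∑w≡K ⟩
    (s * z * n) ^ K                           ≡⟨ power≡ ⟩
    (s ^ s) ^ f * z ^ z * n ^ K * c           ∎)
    where
    open ≤-Reasoning
    x = f * s
    K = x + z
    n = q + ∑ m
    mˢ = ∏ (λ i → m i ^ s)
    c = s ^ z * z ^ x
    0<c : 0 < c
    0<c = *-mono-≤ (m^n>0 s {{>-nonZero 0<s}} z) (m^n>0 z {{>-nonZero 0<z}} x)
    w a : Fin (suc f) → ℕ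
    w = z ◂ (λ _ → s)
    a = (q * s) ◂ (λ i → m i * z)
    ∑w≡K : ∑ w ≡ K
    ∑w≡K = trans (cong (z +_) (∑-const f s)) (+-comm z x)
    zˣ≡ : ∏ {f} (λ _ → z ^ s) ≡ z ^ x
    zˣ≡ = trans (∏-const f (z ^ s)) (trans (^-*-assoc z s f) (cong (z ^_) (*-comm s f)))
    product≡ : q ^ z * mˢ * c ≡ ∏ (λ j → a j ^ w j)
    product≡ = begin-equality
      q ^ z * mˢ * (s ^ z * z ^ x)                         ≡⟨ solve 4 (λ a b c d → a :* b :* (c :* d) := (a :* c) :* (b :* d))
                                                                refl (q ^ z) mˢ (s ^ z) (z ^ x) ⟩
      (q ^ z * s ^ z) * (mˢ * z ^ x)                       ≡⟨ cong₂ _*_ (sym (^-distribʳ-* q s z))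
                                                                (cong (mˢ *_) (sym zˣ≡)) ⟩
      (q * s) ^ z * (mˢ * ∏ {f} (λ _ → z ^ s))             ≡⟨ cong ((q * s) ^ z *_) (sym (∏-distrib-* (λ i → m i ^ s) (λ _ → z ^ s))) ⟩
      (q * s) ^ z * ∏ (λ i → m i ^ s * z ^ s)              ≡⟨ cong ((q * s) ^ z *_) (∏-cong (λ i → sym (^-distribʳ-* (m i) z s))) ⟩
      (q * s) ^ z * ∏ (λ i → (m i * z) ^ s)                ∎
    sum≡ : ∑ (λ j → w j * a j) ≡ s * z * n
    sum≡ = begin-equality
      z * (q * s) + ∑ (λ i → s * (m i * z))                ≡⟨ cong (z * (q * s) +_) (∑-cong (λ i →
                                                                solve 3 (λ s m z → s :* (m :* z) := s :* z :* m) refl s (m i) z)) ⟩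
      z * (q * s) + ∑ (λ i → s * z * m i)                  ≡⟨ cong (z * (q * s) +_) (sym (*-distribˡ-sum (s * z) m)) ⟩
      z * (q * s) + s * z * ∑ m                            ≡⟨ solve 4 (λ s z q M → z :* (q :* s) :+ s :* z :* M := s :* z :* (q :+ M))
                                                                refl s z q (∑ m) ⟩
      s * z * n                                            ∎
    power≡ : (s * z * n) ^ K ≡ (s ^ s) ^ f * z ^ z * n ^ K * c
    power≡ = begin-equality
      (s * z * n) ^ K                                      ≡⟨ trans (^-distribʳ-* (s * z) n K) (cong (_* n ^ K) (^-distribʳ-* s z K)) ⟩
      s ^ K * z ^ K * n ^ K                                ≡⟨ cong₂ (λ a b → a * b * n ^ K) (^-distribˡ-+-* s x z) (^-distribˡ-+-* z x z) ⟩
      s ^ x * s ^ z * (z ^ x * z ^ z) * n ^ K              ≡⟨ solve 5 (λ a b c d e → a :* b :* (c :* d) :* e := a :* d :* e :* (b :* c))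
                                                                refl (s ^ x) (s ^ z) (z ^ x) (z ^ z) (n ^ K) ⟩
      s ^ x * z ^ z * n ^ K * c                            ≡⟨ cong (λ e → e * z ^ z * n ^ K * c)
                                                                (sym (trans (^-*-assoc s s f) (cong (s ^_) (*-comm s f)))) ⟩
      (s ^ s) ^ f * z ^ z * n ^ K * c                      ∎

  ^-mean-value : ∀ z d j → (z + d) ^ j * (z + d) ≤ z ^ j * (z + d) + j * d * (z + d) ^ j
  ^-mean-value z d zero    = m≤m+n (1 * (z + d)) 0
  ^-mean-value z d (suc j) = begin
    (z + d) * a * (z + d)                          ≡⟨ *-assoc (z + d) a (z + d) ⟩
    (z + d) * (a * (z + d))                        ≤⟨ *-monoʳ-≤ (z + d) (^-mean-value z d j) ⟩
    (z + d) * (b * (z + d) + j * d * a)            ≡⟨ solve 5 (λ z d j a b → (z :+ d) :* (b :* (z :+ d) :+ j :* d :* a)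
                                                        := b :* (z :+ d) :* z :+ b :* (z :+ d) :* d :+ j :* d :* ((z :+ d) :* a)) refl z d j a b ⟩
    b * (z + d) * z + b * (z + d) * d + j * d * ((z + d) * a)
                                                   ≤⟨ +-monoˡ-≤ (j * d * ((z + d) * a)) (+-monoʳ-≤ (b * (z + d) * z)
                                                        (*-monoˡ-≤ d (*-monoˡ-≤ (z + d) (^-monoˡ-≤ j (m≤m+n z d))))) ⟩
    b * (z + d) * z + a * (z + d) * d + j * d * ((z + d) * a)
                                                   ≡⟨ solve 5 (λ z d j a b → b :* (z :+ d) :* z :+ a :* (z :+ d) :* d :+ j :* d :* ((z :+ d) :* a)
                                                        := (z :* b) :* (z :+ d) :+ (con 1 :+ j) :* d :* ((z :+ d) :* a)) refl z d j a b ⟩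
    z * b * (z + d) + suc j * d * ((z + d) * a)    ∎
    where
    open ≤-Reasoning
    a = (z + d) ^ j
    b = z ^ j

  [z/K]^z≤1 : ∀ x z → z ^ z * (x + z) ^ x ≤ (x + z) ^ (x + z)
  [z/K]^z≤1 x z = begin
    z ^ z * (x + z) ^ x              ≤⟨ *-monoˡ-≤ ((x + z) ^ x) (^-monoˡ-≤ z (m≤n+m z x)) ⟩
    (x + z) ^ z * (x + z) ^ x        ≡⟨ sym (^-distribˡ-+-* (x + z) z x) ⟩
    (x + z) ^ (z + x)                ≡⟨ cong ((x + z) ^_) (+-comm z x) ⟩
    (x + z) ^ (x + z)                ∎
    where open ≤-Reasoning

  [z/K]^z≤[z/K]^K+x²/K : ∀ x z →
    z ^ z * (x + z) ^ x * (x + z) ≤ z ^ (x + z) * (x + z) + x * x * (x + z) ^ (x + z)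
  [z/K]^z≤[z/K]^K+x²/K x z = begin
    z ^ z * K ^ x * K                       ≡⟨ *-assoc (z ^ z) (K ^ x) K ⟩
    z ^ z * (K ^ x * K)                     ≤⟨ *-monoʳ-≤ (z ^ z) (subst (λ e → e ^ x * e ≤ z ^ x * e + x * x * e ^ x)
                                                 (+-comm z x) (^-mean-value z x x)) ⟩
    z ^ z * (z ^ x * K + x * x * K ^ x)     ≡⟨ solve 5 (λ a b K x c → a :* (b :* K :+ x :* x :* c) := (a :* b) :* K :+ x :* x :* (a :* c))
                                                 refl (z ^ z) (z ^ x) K x (K ^ x) ⟩
    z ^ z * z ^ x * K + x * x * (z ^ z * K ^ x)
                                            ≤⟨ +-monoʳ-≤ (z ^ z * z ^ x * K) (*-monoʳ-≤ (x * x) ([z/K]^z≤1 x z)) ⟩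
    z ^ z * z ^ x * K + x * x * K ^ K       ≡⟨ cong (λ e → e * K + x * x * K ^ K)
                                                 (trans (sym (^-distribˡ-+-* z z x)) (cong (z ^_) (+-comm z x))) ⟩
    z ^ K * K + x * x * K ^ K               ∎
    where
    open ≤-Reasoning
    K = x + z

module NatFractions where

  import Data.Integer as ℤ
  import Data.Integer.Properties as ℤ
  open import Data.Empty using (⊥-elim)
  open import Data.Nat using (ℕ; zero; suc; _+_; _*_; _≤_; _<_; z≤n; s≤s; NonZero; >-nonZero)
  open import Data.Nat.Properties
  open import Data.Nat.Solver using (module +-*-Solver)
  open import Data.Product using (_,_; ∃-syntax)
  open import Data.Rational as ℚ using (ℚ; 0ℚ; toℚᵘ)
  import Data.Rational.Properties as ℚ
  open import Data.Rational.Unnormalised as ℚᵘ using (mkℚᵘ; *≤*)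
  import Data.Rational.Unnormalised.Properties as ℚᵘ
  open import Relation.Binary.PropositionalEquality

  open +-*-Solver

  infixl 7 _÷_

  -- a ÷ d is the rational a / d, with the junk value 0 at d = 0.
  _÷_ : ℕ → ℕ → ℚ
  a ÷ zero  = 0ℚ
  a ÷ suc d = ℤ.+ a ℚ./ suc d

  ÷≡/ : ∀ a d .{{_ : NonZero d}} → a ÷ d ≡ ℤ.+ a ℚ./ d
  ÷≡/ a (suc d) = refl

  toℚᵘ-÷ : ∀ a d .{{_ : NonZero d}} → toℚᵘ (a ÷ d) ℚᵘ.≃ (ℤ.+ a) ℚᵘ./ d
  toℚᵘ-÷ a (suc d) = ℚ.toℚᵘ-fromℚᵘ (mkℚᵘ (ℤ.+ a) d)

  ÷-mono-≤ : ∀ a c d e .{{_ : NonZero d}} .{{_ : NonZero e}} → a * e ≤ c * d → a ÷ d ℚ.≤ c ÷ e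
  ÷-mono-≤ a c d e ae≤cd = ℚ.toℚᵘ-cancel-≤
    (ℚᵘ.≤-respˡ-≃ (ℚᵘ.≃-sym (toℚᵘ-÷ a d)) (ℚᵘ.≤-respʳ-≃ (ℚᵘ.≃-sym (toℚᵘ-÷ c e)) (cross d e ae≤cd)))
    where
    cross : ∀ d e .{{_ : NonZero d}} .{{_ : NonZero e}} → a * e ≤ c * d → (ℤ.+ a) ℚᵘ./ d ℚᵘ.≤ (ℤ.+ c) ℚᵘ./ e
    cross (suc d) (suc e) ae≤cd = *≤* (subst₂ ℤ._≤_ (ℤ.pos-* a (suc e)) (ℤ.pos-* c (suc d)) (ℤ.+≤+ ae≤cd))

  0≤÷ : ∀ a d → 0ℚ ℚ.≤ a ÷ d
  0≤÷ a zero    = ℚ.≤-refl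
  0≤÷ a (suc d) = ÷-mono-≤ 0 a 1 (suc d) z≤n

  ÷-+ : ∀ a b c d .{{_ : NonZero b}} .{{_ : NonZero d}} → a ÷ b ℚ.+ c ÷ d ≡ (a * d + c * b) ÷ (b * d)
  ÷-+ a (suc b) c (suc d) = ℚ.toℚᵘ-injective (ℚᵘ.≃-trans (ℚ.toℚᵘ-homo-+ (a ÷ suc b) (c ÷ suc d))
    (ℚᵘ.≃-trans (ℚᵘ.+-cong (toℚᵘ-÷ a (suc b)) (toℚᵘ-÷ c (suc d)))
    (ℚᵘ.≃-trans (ℚᵘ.≃-reflexive numerator) (ℚᵘ.≃-sym (toℚᵘ-÷ (a * suc d + c * suc b) (suc b * suc d))))))
    where
    numerator : mkℚᵘ (ℤ.+ a ℤ.* ℤ.+ suc d ℤ.+ ℤ.+ c ℤ.* ℤ.+ suc b) (d + b * suc d)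
              ≡ mkℚᵘ (ℤ.+ (a * suc d + c * suc b)) (d + b * suc d)
    numerator = cong (λ n → mkℚᵘ n (d + b * suc d))
      (trans (cong₂ ℤ._+_ (sym (ℤ.pos-* a (suc d))) (sym (ℤ.pos-* c (suc b)))) (sym (ℤ.pos-+ (a * suc d) (c * suc b))))

  ÷-* : ∀ a b c d → (a ÷ b) ℚ.* (c ÷ d) ≡ (a * c) ÷ (b * d)
  ÷-* a zero    c d       = ℚ.*-zeroˡ (c ÷ d)
  ÷-* a (suc b) c zero    = trans (ℚ.*-zeroʳ (a ÷ suc b)) (cong ((a * c) ÷_) (sym (*-zeroʳ (suc b))))
  ÷-* a (suc b) c (suc d) = ℚ.toℚᵘ-injective (ℚᵘ.≃-trans (ℚ.toℚᵘ-homo-* (a ÷ suc b) (c ÷ suc d))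
    (ℚᵘ.≃-trans (ℚᵘ.*-cong (toℚᵘ-÷ a (suc b)) (toℚᵘ-÷ c (suc d)))
    (ℚᵘ.≃-trans (ℚᵘ.≃-reflexive (cong (λ n → mkℚᵘ n (d + b * suc d)) (sym (ℤ.pos-* a c))))
      (ℚᵘ.≃-sym (toℚᵘ-÷ (a * c) (suc b * suc d))))))

  ≤-÷₃ : ∀ G T a₁ a₂ a₃ d₁ d₂ d₃ .{{_ : NonZero d₁}} .{{_ : NonZero d₂}} .{{_ : NonZero d₃}} →
    G * (d₁ * d₂ * d₃) ≤ T * (a₁ * d₂ * d₃ + a₂ * d₁ * d₃ + a₃ * d₁ * d₂) →
    G ÷ 1 ℚ.≤ (a₁ ÷ d₁ ℚ.+ a₂ ÷ d₂ ℚ.+ a₃ ÷ d₃) ℚ.* (T ÷ 1)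
  ≤-÷₃ G T a₁ a₂ a₃ d₁ d₂ d₃ G*d≤T*a = begin
    G ÷ 1                                                   ≤⟨ ÷-mono-≤ G (a * T) 1 (d₁ * d₂ * d₃ * 1)
                                                                 (subst₂ _≤_ (cong (G *_) (sym (*-identityʳ _)))
                                                                   (trans (*-comm T a) (sym (*-identityʳ _))) G*d≤T*a) ⟩
    (a * T) ÷ (d₁ * d₂ * d₃ * 1)                            ≡⟨ ÷-* a (d₁ * d₂ * d₃) T 1 ⟨
    (a ÷ (d₁ * d₂ * d₃)) ℚ.* (T ÷ 1)                        ≡⟨ cong (ℚ._* (T ÷ 1)) sum≡ ⟨
    (a₁ ÷ d₁ ℚ.+ a₂ ÷ d₂ ℚ.+ a₃ ÷ d₃) ℚ.* (T ÷ 1)           ∎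
    where
    open ℚ.≤-Reasoning
    instance
      _ = m*n≢0 d₁ d₂
      _ = m*n≢0 (d₁ * d₂) d₃
      _ = m*n≢0 (d₁ * d₂ * d₃) 1
    a = a₁ * d₂ * d₃ + a₂ * d₁ * d₃ + a₃ * d₁ * d₂
    sum≡ : a₁ ÷ d₁ ℚ.+ a₂ ÷ d₂ ℚ.+ a₃ ÷ d₃ ≡ a ÷ (d₁ * d₂ * d₃)
    sum≡ = begin-equality
      a₁ ÷ d₁ ℚ.+ a₂ ÷ d₂ ℚ.+ a₃ ÷ d₃                       ≡⟨ cong (ℚ._+ a₃ ÷ d₃) (÷-+ a₁ d₁ a₂ d₂) ⟩
      (a₁ * d₂ + a₂ * d₁) ÷ (d₁ * d₂) ℚ.+ a₃ ÷ d₃           ≡⟨ ÷-+ (a₁ * d₂ + a₂ * d₁) (d₁ * d₂) a₃ d₃ ⟩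
      ((a₁ * d₂ + a₂ * d₁) * d₃ + a₃ * (d₁ * d₂)) ÷ (d₁ * d₂ * d₃)
                                                            ≡⟨ cong (_÷ (d₁ * d₂ * d₃))
                                                                 (solve 6 (λ a₁ a₂ a₃ d₁ d₂ d₃ → (a₁ :* d₂ :+ a₂ :* d₁) :* d₃ :+ a₃ :* (d₁ :* d₂)
                                                                   := a₁ :* d₂ :* d₃ :+ a₂ :* d₁ :* d₃ :+ a₃ :* d₁ :* d₂) refl a₁ a₂ a₃ d₁ d₂ d₃) ⟩
      a ÷ (d₁ * d₂ * d₃)                                    ∎

  1/[1+d]≤pos : ∀ δ → 0ℚ ℚ.< δ → ∃[ d ] (1 ÷ suc d ℚ.≤ δ)
  1/[1+d]≤pos δ@(ℚ.mkℚ (ℤ.+ suc a) d _) _ = d , ℚ.≤-trans (÷-mono-≤ 1 (suc a) (suc d) (suc d)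
    (*-monoˡ-≤ (suc d) {1} {suc a} (s≤s z≤n))) (ℚ.≤-reflexive (ℚ.↥p/↧p≡p δ))
  1/[1+d]≤pos (ℚ.mkℚ (ℤ.+ zero) d _) (ℚ.*<* 0<0) = ⊥-elim (ℤ.<-irrefl refl 0<0)
  1/[1+d]≤pos (ℚ.mkℚ ℤ.-[1+ a ] d _) (ℚ.*<* ())

  a÷[c*n]→0 : ∀ a c → 0 < c → ∀ δ → 0ℚ ℚ.< δ → ∃[ N ] ∀ n → N ≤ n → a ÷ (c * n) ℚ.≤ δ
  a÷[c*n]→0 a c 0<c δ 0<δ with 1/[1+d]≤pos δ 0<δ
  ... | d , 1/[1+d]≤δ = a * suc d , λ n a[1+d]≤n → ℚ.≤-trans (a÷[c*n]≤1/[1+d] n a[1+d]≤n) 1/[1+d]≤δ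
    where
    a÷[c*n]≤1/[1+d] : ∀ n → a * suc d ≤ n → a ÷ (c * n) ℚ.≤ 1 ÷ suc d
    a÷[c*n]≤1/[1+d] zero    _         rewrite *-zeroʳ c = 0≤÷ 1 (suc d)
    a÷[c*n]≤1/[1+d] (suc n) a[1+d]≤n  = ÷-mono-≤ a 1 (c * suc n) (suc d) {{m*n≢0 c (suc n) {{>-nonZero 0<c}}}}
      (≤-trans a[1+d]≤n (≤-trans (m≤n*m (suc n) c {{>-nonZero 0<c}}) (≤-reflexive (sym (*-identityˡ _)))))

module Exponential where

  open import Data.Nat using (ℕ; zero; suc; _+_; _*_; _^_; _≤_; _<_; _!)
  open import Data.Nat.Combinatorics using (_C_; nCn≡1; nCk+nC[k+1]≡[n+1]C[k+1])
  open import Data.Nat.Properties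
  open import Data.Nat.Solver using (module +-*-Solver)
  open import Data.Rational as ℚ using (0ℚ; 1ℚ; nonNegative)
  import Data.Rational.Properties as ℚ
  open import Relation.Binary.PropositionalEquality

  open import Defs
  open +-*-Solver
  open Inequalities using ([1+r]^j≤j!*[r+j]Cj)
  open NatFractions

  -- negBinomial x z r M = Σ_{j<M} C(r+j, j) x^j (x+z)^(M−j) is (x+z)^M times the
  -- M-th partial sum of (1 − x/(x+z))^−(r+1) = Σ_j C(r+j, j) (x/(x+z))^j.
  negBinomial : ℕ → ℕ → ℕ → ℕ → ℕ
  negBinomial x z r zero    = 0
  negBinomial x z r (suc M) = (x + z) * negBinomial x z r M + ((r + M) C M) * x ^ M * (x + z)

  negBinomialTail : ℕ → ℕ → ℕ → ℕ → ℕ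
  negBinomialTail x z r zero    = 0
  negBinomialTail x z r (suc M) = (x + z) * ((r + suc M) C M) * x ^ suc M

  negBinomialTail-pascal : ∀ x z r M →
    (x + z) * (suc (r + M) C M) * x ^ M ≡ negBinomialTail x z r M + (x + z) * ((r + M) C M) * x ^ M
  negBinomialTail-pascal x z r zero    = refl
  negBinomialTail-pascal x z r (suc M) = begin
    (x + z) * (suc n C suc M) * x ^ suc M                             ≡⟨ cong (λ c → (x + z) * c * x ^ suc M)
                                                                           (sym (nCk+nC[k+1]≡[n+1]C[k+1] n M)) ⟩
    (x + z) * (n C M + n C suc M) * x ^ suc M                         ≡⟨ solve 4 (λ d a b y → d :* (a :+ b) :* y := d :* a :* y :+ d :* b :* y)
                                                                           refl (x + z) (n C M) (n C suc M) (x ^ suc M) ⟩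
    (x + z) * (n C M) * x ^ suc M + (x + z) * (n C suc M) * x ^ suc M ∎
    where
    open ≡-Reasoning
    n = r + suc M

  -- Multiplying the series of (1 − t)^−(r+2) by 1 − t gives that of (1 − t)^−(r+1); after
  -- truncation the difference is negBinomialTail.
  negBinomial-step : ∀ x z r M →
    z * negBinomial x z (suc r) M + negBinomialTail x z r M ≡ (x + z) * negBinomial x z r M
  negBinomial-step x z r zero    = trans (cong (_+ 0) (*-zeroʳ z)) (sym (*-zeroʳ (x + z)))
  negBinomial-step x z r (suc M) = begin
    z * (k * a′ + c₁ * y * k) + k * ((r + suc M) C M) * (x * y)
      ≡⟨ cong (λ n → z * (k * a′ + c₁ * y * k) + k * (n C M) * (x * y)) (+-suc r M) ⟩
    z * (k * a′ + c₁ * y * k) + k * c₁ * (x * y)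
      ≡⟨ solve 5 (λ z x a′ c₁ y → z :* ((x :+ z) :* a′ :+ c₁ :* y :* (x :+ z)) :+ (x :+ z) :* c₁ :* (x :* y)
                                   := (x :+ z) :* (z :* a′) :+ (x :+ z) :* ((x :+ z) :* c₁ :* y)) refl z x a′ c₁ y ⟩
    k * (z * a′) + k * (k * c₁ * y)
      ≡⟨ cong (λ t → k * (z * a′) + k * t) (negBinomialTail-pascal x z r M) ⟩
    k * (z * a′) + k * (negBinomialTail x z r M + k * c₀ * y)
      ≡⟨ solve 5 (λ k za t c₀ y → k :* za :+ k :* (t :+ k :* c₀ :* y) := k :* (za :+ t) :+ k :* (c₀ :* y :* k))
           refl k (z * a′) (negBinomialTail x z r M) c₀ y ⟩
    k * (z * a′ + negBinomialTail x z r M) + k * (c₀ * y * k)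
      ≡⟨ cong (λ t → k * t + k * (c₀ * y * k)) (negBinomial-step x z r M) ⟩
    k * (k * negBinomial x z r M) + k * (c₀ * y * k)
      ≡⟨ sym (*-distribˡ-+ k _ _) ⟩
    k * (k * negBinomial x z r M + c₀ * y * k) ∎
    where
    open ≡-Reasoning
    k  = x + z
    a′ = negBinomial x z (suc r) M
    c₁ = suc (r + M) C M
    c₀ = (r + M) C M
    y  = x ^ M

  negBinomial-base : ∀ x z M → z * negBinomial x z 0 M + (x + z) * x ^ M ≡ (x + z) ^ suc M
  negBinomial-base x z zero    = cong (_+ (x + z) * 1) (*-zeroʳ z)
  negBinomial-base x z (suc M) = begin
    z * (k * a + (M C M) * y * k) + k * (x * y)  ≡⟨ cong (λ c → z * (k * a + c * y * k) + k * (x * y)) (nCn≡1 M) ⟩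
    z * (k * a + 1 * y * k) + k * (x * y)        ≡⟨ solve 5 (λ z x a y k → z :* (k :* a :+ con 1 :* y :* k) :+ k :* (x :* y)
                                                      := k :* (z :* a :+ (x :+ z) :* y)) refl z x a y k ⟩
    k * (z * a + k * y)                          ≡⟨ cong (k *_) (negBinomial-base x z M) ⟩
    k * k ^ suc M                                ∎
    where
    open ≡-Reasoning
    k = x + z
    a = negBinomial x z 0 M
    y = x ^ M

  z^[1+r]*negBinomial≤[x+z]^[1+r+M] : ∀ x z r M → z ^ suc r * negBinomial x z r M ≤ (x + z) ^ (suc r + M)
  z^[1+r]*negBinomial≤[x+z]^[1+r+M] x z zero M = begin
    z * 1 * negBinomial x z 0 M                        ≡⟨ cong (_* negBinomial x z 0 M) (*-identityʳ z) ⟩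
    z * negBinomial x z 0 M                            ≤⟨ m≤m+n _ _ ⟩
    z * negBinomial x z 0 M + (x + z) * x ^ M          ≡⟨ negBinomial-base x z M ⟩
    (x + z) ^ suc M                                    ∎
    where open ≤-Reasoning
  z^[1+r]*negBinomial≤[x+z]^[1+r+M] x z (suc r) M = begin
    z * z ^ suc r * a′                                 ≡⟨ solve 3 (λ z zʳ a′ → z :* zʳ :* a′ := zʳ :* (z :* a′)) refl z (z ^ suc r) a′ ⟩
    z ^ suc r * (z * a′)                               ≤⟨ *-monoʳ-≤ (z ^ suc r) (≤-trans (m≤m+n _ _) (≤-reflexive (negBinomial-step x z r M))) ⟩
    z ^ suc r * ((x + z) * a)                          ≡⟨ solve 3 (λ zʳ k a → zʳ :* (k :* a) := k :* (zʳ :* a)) refl (z ^ suc r) (x + z) a ⟩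
    (x + z) * (z ^ suc r * a)                          ≤⟨ *-monoʳ-≤ (x + z) (z^[1+r]*negBinomial≤[x+z]^[1+r+M] x z r M) ⟩
    (x + z) * (x + z) ^ (suc r + M)                    ∎
    where
    open ≤-Reasoning
    a′ = negBinomial x z (suc r) M
    a  = negBinomial x z r M

  expPartial≤negBinomial : ∀ x z r → x + z ≡ suc r → ∀ M →
    expPartial x M ℚ.≤ negBinomial x z r M ÷ suc r ^ M
  expPartial≤negBinomial x z r x+z≡k zero    = ℚ.≤-refl
  expPartial≤negBinomial x z r x+z≡k (suc M) = begin
    expPartial x (suc M)                         ≡⟨ cong (expPartial x M ℚ.+_) (sym (÷≡/ y (M !))) ⟩
    expPartial x M ℚ.+ y ÷ M !                   ≤⟨ ℚ.+-monoˡ-≤ (y ÷ M !) (expPartial≤negBinomial x z r x+z≡k M) ⟩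
    a ÷ kᴹ ℚ.+ y ÷ M !                           ≡⟨ ÷-+ a kᴹ y (M !) ⟩
    (a * M ! + y * kᴹ) ÷ (kᴹ * M !)              ≤⟨ ÷-mono-≤ (a * M ! + y * kᴹ) a′ (kᴹ * M !) (suc r ^ suc M)
                                                      (subst (λ k → (a * M ! + y * kᴹ) * (k * kᴹ) ≤ a′ * (kᴹ * M !)) x+z≡k
                                                        (cross a y (M !) kᴹ (x + z) ((r + M) C M) kᴹ≤c*M!)) ⟩
    a′ ÷ suc r ^ suc M                           ∎
    where
    open ℚ.≤-Reasoning
    a  = negBinomial x z r M
    a′ = negBinomial x z r (suc M)
    y  = x ^ M
    kᴹ = suc r ^ M
    instance
      _ = M !≢0
      _ = m^n≢0 (suc r) M
      _ = m^n≢0 (suc r) (suc M)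
      _ = m*n≢0 kᴹ (M !)
    kᴹ≤c*M! : kᴹ ≤ ((r + M) C M) * M !
    kᴹ≤c*M! = ≤-trans ([1+r]^j≤j!*[r+j]Cj r M) (≤-reflexive (*-comm (M !) _))
    cross : ∀ a y f p d c → p ≤ c * f → (a * f + y * p) * (d * p) ≤ (d * a + c * y * d) * (p * f)
    cross a y f p d c p≤cf = ≤-trans
      (≤-reflexive (solve 6 (λ a y f p d c → (a :* f :+ y :* p) :* (d :* p)
                              := d :* a :* (p :* f) :+ (y :* d :* p) :* p) refl a y f p d c))
      (≤-trans (+-monoʳ-≤ (d * a * (p * f)) (*-monoʳ-≤ (y * d * p) p≤cf))
      (≤-reflexive (solve 6 (λ a y f p d c → d :* a :* (p :* f) :+ (y :* d :* p) :* (c :* f)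
                              := (d :* a :+ c :* y :* d) :* (p :* f)) refl a y f p d c)))

  0≤expPartial : ∀ x M → 0ℚ ℚ.≤ expPartial x M
  0≤expPartial x zero    = ℚ.≤-refl
  0≤expPartial x (suc M) = ℚ.+-mono-≤ (0≤expPartial x M) (subst (0ℚ ℚ.≤_) (÷≡/ (x ^ M) (M !) {{M !≢0}}) (0≤÷ (x ^ M) (M !)))

  [z/K]^K*expPartial≤1 : ∀ x z → 0 < z → ∀ M → (z ^ (x + z) ÷ (x + z) ^ (x + z)) ℚ.* expPartial x M ℚ.≤ 1ℚ
  [z/K]^K*expPartial≤1 x z@(suc z′) _ M rewrite +-suc x z′ = begin
    (zᵏ ÷ kᵏ) ℚ.* expPartial x M                 ≤⟨ ℚ.*-monoˡ-≤-nonNeg (zᵏ ÷ kᵏ) {{nonNegative (0≤÷ zᵏ kᵏ)}}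
                                                      (expPartial≤negBinomial x z r x+z≡k M) ⟩
    (zᵏ ÷ kᵏ) ℚ.* (a ÷ suc r ^ M)                ≡⟨ ÷-* zᵏ kᵏ a (suc r ^ M) ⟩
    (zᵏ * a) ÷ (kᵏ * suc r ^ M)                  ≤⟨ ÷-mono-≤ (zᵏ * a) 1 (kᵏ * suc r ^ M) 1 zᵏa≤kᵏkᴹ ⟩
    1ℚ                                           ∎
    where
    open ℚ.≤-Reasoning
    r : ℕ
    r = x + z′
    x+z≡k : x + z ≡ suc r
    x+z≡k = +-suc x z′
    zᵏ = z ^ suc r
    kᵏ = suc r ^ suc r
    a  = negBinomial x z r M
    instance _ = m*n≢0 kᵏ (suc r ^ M) {{m^n≢0 (suc r) (suc r)}} {{m^n≢0 (suc r) M}}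
    zᵏa≤kᵏkᴹ : zᵏ * a * 1 ≤ 1 * (kᵏ * suc r ^ M)
    zᵏa≤kᵏkᴹ = ≤-trans (≤-reflexive (*-identityʳ _)) (≤-trans (z^[1+r]*negBinomial≤[x+z]^[1+r+M] x z r M)
      (≤-reflexive (trans (cong (λ k → k ^ (suc r + M)) x+z≡k)
        (trans (^-distribˡ-+-* (suc r) (suc r) M) (sym (*-identityˡ _))))))

module MainBound where

  open import Data.Fin using (Fin; zero)
  open import Data.Fin.Subset using (Subset; ∣_∣)
  open import Data.List using (length)
  open import Data.List.Properties using (length-filter)
  open import Data.Nat using (ℕ; zero; suc; _+_; _*_; _^_; _≤_; _<_; _!; >-nonZero)
  open import Data.Nat.Combinatorics using (_C_)
  open import Data.Nat.Combinatorics.Base using (_P′_)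
  open import Data.Nat.Properties
  open import Data.Nat.Solver using (module +-*-Solver)
  open import Data.Product using (_,_)
  open import Data.Rational as ℚ using (ℚ; 0ℚ; 1ℚ; nonNegative)
  import Data.Rational.Properties as ℚ
  open import Function using (_∘_)
  open import Relation.Binary.PropositionalEquality
  open import Relation.Nullary using (yes; no)
  open import Relation.Nullary.Decidable.Core using (T?)

  open import Defs
  open +-*-Solver
  open FiniteSums
  open Counting
  open Inequalities
  open NatFractions
  open Exponential

  numerator denominator : ℕ → ℕ → ℕ
  numerator   f s = (s ^ s) ^ f
  denominator f s = (s !) ^ f

  0<denominator : ∀ f s → 0 < denominator f s
  0<denominator f s = m^n>0 (s !) {{s !≢0}} f

  denominator≤numerator : ∀ f s → denominator f s ≤ numerator f s
  denominator≤numerator f s = ^-monoˡ-≤ f (n!≤n^n s)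
    where
    n!≤n^n : ∀ n → n ! ≤ n ^ n
    n!≤n^n zero    = ≤-refl
    n!≤n^n (suc n) = *-monoʳ-≤ (suc n) (≤-trans (n!≤n^n n) (^-monoˡ-≤ n (n≤1+n n)))

  ε₁ : ℕ → ℕ → ℕ → ℚ
  ε₁ f s k = (numerator f s * (f * s * (f * s))) ÷ (denominator f s * k)

  ε₂ : ℕ → ℕ → ℕ → ℕ → ℚ
  ε₂ f s n k = (2 * numerator f s * (k * k)) ÷ (denominator f s * n)

  0≤ε₁ : ∀ f s k → 0ℚ ℚ.≤ ε₁ f s k
  0≤ε₁ f s k = 0≤÷ (numerator f s * (f * s * (f * s))) (denominator f s * k)

  0≤ε₂ : ∀ f s n k → 0ℚ ℚ.≤ ε₂ f s n k
  0≤ε₂ f s n k = 0≤÷ (2 * numerator f s * (k * k)) (denominator f s * n)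

  module MainCase {n f s z : ℕ} (R : Fin f → Subset n) (disjoint : PairwiseDisjoint R) (0<s : 0 < s) (0<z : 0 < z) where

    x K G T F S q : ℕ
    x = f * s
    K = x + z
    G = goodCount n K f s R
    T = n C K
    F = denominator f s
    S = numerator f s
    q = ∣ fibre (colour R) zero ∣

    m : Fin f → ℕ
    m i = ∣ R i ∣

    0<K : 0 < K
    0<K = ≤-trans 0<z (m≤n+m z x)

    G≡qCz*∏mCs : G ≡ (q C z) * ∏ (λ i → m i C s)
    G≡qCz*∏mCs = trans (goodCount≡ R disjoint (m≤m+n x z)) (cong (λ z → (q C z) * ∏ (λ i → m i C s)) (m+n∸m≡n x z))

    n≡q+∑m : n ≡ q + ∑ m
    n≡q+∑m = trans (n≡∑∣fibre∣ (colour R)) (cong (q +_) (∑-cong (λ i → cong ∣_∣ (fibre-colour R disjoint i))))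

    G*F*z!≤q^z*∏mˢ : G * F * z ! ≤ q ^ z * ∏ (λ i → m i ^ s)
    G*F*z!≤q^z*∏mˢ = begin
      G * F * z !                                          ≡⟨ cong (λ g → g * F * z !) G≡qCz*∏mCs ⟩
      (q C z) * ∏ (λ i → m i C s) * F * z !                ≡⟨ solve 4 (λ a b c d → a :* b :* c :* d := (a :* d) :* (b :* c))
                                                                refl (q C z) (∏ (λ i → m i C s)) F (z !) ⟩
      ((q C z) * z !) * (∏ (λ i → m i C s) * F)            ≤⟨ *-mono-≤ (nCk*k!≤n^k q z) (∏C*k!^f≤∏^ m s) ⟩
      q ^ z * ∏ (λ i → m i ^ s)                            ∎
      where open ≤-Reasoning

    S*zᴷ÷[F*Kᴷ]<r : ∀ r → ConstLt f s r → (S * z ^ K) ÷ (F * K ^ K) ℚ.< r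
    S*zᴷ÷[F*Kᴷ]<r r (N , c<rE) = ℚ.*-cancelʳ-<-nonNeg E {{nonNegative (0≤expPartial (s * f) N)}} (begin-strict
      (S * z ^ K) ÷ (F * K ^ K) ℚ.* E                ≡⟨ cong (ℚ._* E) (÷-* S F (z ^ K) (K ^ K)) ⟨
      (S ÷ F) ℚ.* (z ^ K ÷ K ^ K) ℚ.* E              ≡⟨ ℚ.*-assoc (S ÷ F) (z ^ K ÷ K ^ K) E ⟩
      (S ÷ F) ℚ.* ((z ^ K ÷ K ^ K) ℚ.* E)            ≤⟨ ℚ.*-monoˡ-≤-nonNeg (S ÷ F) {{nonNegative (0≤÷ S F)}} exp≤1 ⟩
      (S ÷ F) ℚ.* 1ℚ                                 ≡⟨ ℚ.*-identityʳ (S ÷ F) ⟩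
      S ÷ F                                          ≡⟨ ÷≡/ S F {{m^n≢0 (s !) f {{s !≢0}}}} ⟩
      numConst f s                                   <⟨ c<rE ⟩
      r ℚ.* E                                        ∎)
      where
      open ℚ.≤-Reasoning
      E = expPartial (s * f) N
      exp≤1 : (z ^ K ÷ K ^ K) ℚ.* E ℚ.≤ 1ℚ
      exp≤1 = subst (λ y → (z ^ (y + z) ÷ (y + z) ^ (y + z)) ℚ.* E ℚ.≤ 1ℚ) (*-comm s f) ([z/K]^K*expPartial≤1 (s * f) z 0<z N)

    module _ (2K²≤n : 2 * K * K ≤ n) where

      K≤n : K ≤ n
      K≤n = ≤-trans (m≤m*n K K {{>-nonZero 0<K}}) (≤-trans (*-monoˡ-≤ K (m≤n*m K 2)) 2K²≤n)

      G/T≤S/F*[z/K]^z*[1+2K²/n] : G * F * K ^ K * n ≤ T * S * (z ^ z * K ^ x) * (n + 2 * K * K)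
      G/T≤S/F*[z/K]^z*[1+2K²/n] = *-cancelʳ-≤ _ _ (K !) {{K !≢0}} (begin
        G * F * K ^ K * n * K !                          ≤⟨ *-monoʳ-≤ (G * F * K ^ K * n) ([m+n]!≤n!*[m+n]^m x z) ⟩
        G * F * K ^ K * n * (z ! * K ^ x)                ≡⟨ solve 6 (λ g c kᵏ n z! kˣ → g :* c :* kᵏ :* n :* (z! :* kˣ)
                                                              := (g :* c :* z!) :* (kᵏ :* (kˣ :* n))) refl G F (K ^ K) n (z !) (K ^ x) ⟩
        (G * F * z !) * (K ^ K * (K ^ x * n))            ≤⟨ *-monoˡ-≤ (K ^ K * (K ^ x * n)) G*F*z!≤q^z*∏mˢ ⟩
        Π * (K ^ K * (K ^ x * n))                        ≡⟨ trans (sym (*-assoc Π (K ^ K) _)) (cong (_* (K ^ x * n)) (*-comm Π (K ^ K))) ⟩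
        (K ^ K * Π) * (K ^ x * n)                        ≤⟨ *-monoˡ-≤ (K ^ x * n) (subst (λ n → K ^ K * Π ≤ S * z ^ z * n ^ K) (sym n≡q+∑m)
                                                              (am-gm-profile q m 0<s 0<z)) ⟩
        (S * z ^ z * n ^ K) * (K ^ x * n)                ≡⟨ solve 5 (λ c zᶻ nᴷ kˣ n → c :* zᶻ :* nᴷ :* (kˣ :* n)
                                                              := c :* (zᶻ :* kˣ) :* (n :* nᴷ)) refl S (z ^ z) (n ^ K) (K ^ x) n ⟩
        S * (z ^ z * K ^ x) * (n * n ^ K)                ≤⟨ *-monoʳ-≤ (S * (z ^ z * K ^ x)) (n*n^k≤nP′k*[n+2k²] n K (≤-trans 0<K K≤n) 2K²≤n) ⟩
        S * (z ^ z * K ^ x) * ((n P′ K) * (n + 2 * K * K)) ≡⟨ cong (λ p → S * (z ^ z * K ^ x) * (p * (n + 2 * K * K))) (sym (nCk*k!≡nP′k K≤n)) ⟩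
        S * (z ^ z * K ^ x) * (T * K ! * (n + 2 * K * K))  ≡⟨ solve 5 (λ c a t k! b → c :* a :* (t :* k! :* b) := t :* c :* a :* b :* k!)
                                                              refl S (z ^ z * K ^ x) T (K !) (n + 2 * K * K) ⟩
        T * S * (z ^ z * K ^ x) * (n + 2 * K * K) * K !  ∎)
        where
        open ≤-Reasoning
        Π = q ^ z * ∏ (λ i → m i ^ s)

      G/T≤S/F*[[z/K]^K+x²/K+2K²/n] : G * F * K ^ K * K * n ≤ T * S * (z ^ K * K * n + x * x * K ^ K * n + 2 * K * K * K ^ K * K)
      G/T≤S/F*[[z/K]^K+x²/K+2K²/n] = begin
        G * F * K ^ K * K * n                        ≡⟨ solve 5 (λ g c kᴷ k n → g :* c :* kᴷ :* k :* n := (g :* c :* kᴷ :* n) :* k)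
                                                          refl G F (K ^ K) K n ⟩
        (G * F * K ^ K * n) * K                      ≤⟨ *-monoˡ-≤ K G/T≤S/F*[z/K]^z*[1+2K²/n] ⟩
        (T * S * a * (n + 2 * K * K)) * K          ≡⟨ solve 5 (λ t c a n k → (t :* c :* a :* (n :+ con 2 :* k :* k)) :* k
                                                          := t :* c :* ((a :* k) :* n :+ a :* (con 2 :* k :* k :* k))) refl T S a n K ⟩
        T * S * ((a * K) * n + a * (2 * K * K * K)) ≤⟨ *-monoʳ-≤ (T * S) (+-mono-≤ (*-monoˡ-≤ n ([z/K]^z≤[z/K]^K+x²/K x z))
                                                                                    (*-monoˡ-≤ (2 * K * K * K) ([z/K]^z≤1 x z))) ⟩
        T * S * ((z ^ K * K + x * x * K ^ K) * n + K ^ K * (2 * K * K * K))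
                                                     ≡⟨ solve 7 (λ t c zᴷ k x kᴷ n → t :* c :* ((zᴷ :* k :+ x :* x :* kᴷ) :* n :+ kᴷ :* (con 2 :* k :* k :* k))
                                                          := t :* c :* (zᴷ :* k :* n :+ x :* x :* kᴷ :* n :+ con 2 :* k :* k :* kᴷ :* k))
                                                          refl T S (z ^ K) K x (K ^ K) n ⟩
        T * S * (z ^ K * K * n + x * x * K ^ K * n + 2 * K * K * K ^ K * K) ∎
        where
        open ≤-Reasoning
        a = z ^ z * K ^ x

      probLe-main : ∀ r → ConstLt f s r → ProbLe n K f s R (r ℚ.+ ε₁ f s K ℚ.+ ε₂ f s n K)
      probLe-main r c = subst (λ t → G ÷ 1 ℚ.≤ (r ℚ.+ ε₁ f s K ℚ.+ ε₂ f s n K) ℚ.* (t ÷ 1)) (sym (count-size n K)) (begin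
        G ÷ 1                                                  ≤⟨ ≤-÷₃ G T (S * z ^ K) (S * (x * x)) (2 * S * (K * K))
                                                                    (F * K ^ K) (F * K) (F * n) (cross-multiplied) ⟩
        ((S * z ^ K) ÷ (F * K ^ K) ℚ.+ ε₁ f s K ℚ.+ ε₂ f s n K) ℚ.* (T ÷ 1)
                                                               ≤⟨ ℚ.*-monoʳ-≤-nonNeg (T ÷ 1) {{nonNegative (0≤÷ T 1)}}
                                                                    (ℚ.+-monoˡ-≤ (ε₂ f s n K) (ℚ.+-monoˡ-≤ (ε₁ f s K) (ℚ.<⇒≤ (S*zᴷ÷[F*Kᴷ]<r r c)))) ⟩
        (r ℚ.+ ε₁ f s K ℚ.+ ε₂ f s n K) ℚ.* (T ÷ 1)          ∎)
        where
        open ℚ.≤-Reasoning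
        0<n : 0 < n
        0<n = ≤-trans 0<K K≤n
        instance
          _ = >-nonZero 0<K
          _ = >-nonZero 0<n
          _ = m*n≢0 F (K ^ K) {{>-nonZero (0<denominator f s)}} {{m^n≢0 K K}}
          _ = m*n≢0 F K {{>-nonZero (0<denominator f s)}}
          _ = m*n≢0 F n {{>-nonZero (0<denominator f s)}}
        cross-multiplied : G * ((F * K ^ K) * (F * K) * (F * n))
                  ≤ T * (S * z ^ K * (F * K) * (F * n) + S * (x * x) * (F * K ^ K) * (F * n) + 2 * S * (K * K) * (F * K ^ K) * (F * K))
        cross-multiplied = subst₂ _≤_
          (solve 5 (λ g kᴷ k n d → d :* d :* (g :* d :* kᴷ :* k :* n) := g :* ((d :* kᴷ) :* (d :* k) :* (d :* n)))
            refl G (K ^ K) K n F)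
          (solve 8 (λ t c zᴷ k x kᴷ n d → d :* d :* (t :* c :* (zᴷ :* k :* n :+ x :* x :* kᴷ :* n :+ con 2 :* k :* k :* kᴷ :* k))
                    := t :* (c :* zᴷ :* (d :* k) :* (d :* n) :+ c :* (x :* x) :* (d :* kᴷ) :* (d :* n)
                            :+ con 2 :* c :* (k :* k) :* (d :* kᴷ) :* (d :* k)))
            refl T S (z ^ K) K x (K ^ K) n F)
          (*-monoʳ-≤ (F * F) G/T≤S/F*[[z/K]^K+x²/K+2K²/n])

  probLe-of-1≤ : ∀ {n k f s} (R : Fin f → Subset n) {c} → 1ℚ ℚ.≤ c → ProbLe n k f s R c
  probLe-of-1≤ {n} {k} {f} {s} R {c} 1≤c = begin
    G ÷ 1             ≤⟨ ÷-mono-≤ G T 1 1 (*-monoˡ-≤ 1 G≤T) ⟩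
    T ÷ 1             ≡⟨ ℚ.*-identityˡ (T ÷ 1) ⟨
    1ℚ ℚ.* (T ÷ 1)    ≤⟨ ℚ.*-monoʳ-≤-nonNeg (T ÷ 1) {{nonNegative (0≤÷ T 1)}} 1≤c ⟩
    c ℚ.* (T ÷ 1)     ∎
    where
    open ℚ.≤-Reasoning
    G = goodCount n k f s R
    T = length (kSubsets n k)
    G≤T : G ≤ T
    G≤T = length-filter (T? ∘ event R s) (kSubsets n k)

  ConstLt⇒0≤r : ∀ {f s r} → ConstLt f s r → 0ℚ ℚ.≤ r
  ConstLt⇒0≤r {f} {s} {r} (N , c<rE) = ℚ.<⇒≤ (ℚ.*-cancelʳ-<-nonNeg E {{nonNegative (0≤expPartial (s * f) N)}}
    (ℚ.≤-<-trans (ℚ.≤-trans (ℚ.≤-reflexive (ℚ.*-zeroˡ E)) (subst (0ℚ ℚ.≤_) (÷≡/ _ _ {{m^n≢0 (s !) f {{s !≢0}}}}) (0≤÷ (numerator f s) (denominator f s)))) c<rE))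
    where E = expPartial (s * f) N

  p≤q+p+r : ∀ {p q r} → 0ℚ ℚ.≤ q → 0ℚ ℚ.≤ r → p ℚ.≤ q ℚ.+ p ℚ.+ r
  p≤q+p+r {p} {q} {r} 0≤q 0≤r = ℚ.≤-trans (ℚ.≤-reflexive (sym (trans (ℚ.+-identityʳ (0ℚ ℚ.+ p)) (ℚ.+-identityˡ p))))
    (ℚ.+-mono-≤ (ℚ.+-monoˡ-≤ p 0≤q) 0≤r)

  p≤q+r+p : ∀ {p q r} → 0ℚ ℚ.≤ q → 0ℚ ℚ.≤ r → p ℚ.≤ q ℚ.+ r ℚ.+ p
  p≤q+r+p {p} {q} {r} 0≤q 0≤r = ℚ.≤-trans (ℚ.≤-reflexive (sym (ℚ.+-identityˡ p)))
    (ℚ.+-monoˡ-≤ p (ℚ.≤-trans (ℚ.≤-reflexive (sym (ℚ.+-identityʳ 0ℚ))) (ℚ.+-mono-≤ 0≤q 0≤r)))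

  bound : ∀ f s → 0 < s → ∀ n k → 0 < k → k ≤ n → (R : Fin f → Subset n) → PairwiseDisjoint R →
    ∀ r → ConstLt f s r → ProbLe n k f s R (r ℚ.+ ε₁ f s k ℚ.+ ε₂ f s n k)
  bound f s 0<s n k 0<k k≤n R disjoint r c<rE with k ≤? f * s | 2 * k * k ≤? n
  ... | yes k≤x | _ = probLe-of-1≤ R (ℚ.≤-trans 1≤ε₁ (p≤q+p+r {ε₁ f s k} {r} {ε₂ f s n k} (ConstLt⇒0≤r {f} {s} c<rE) (0≤ε₂ f s n k)))
    where
    instance _ = m*n≢0 (denominator f s) k {{>-nonZero (0<denominator f s)}} {{>-nonZero 0<k}}
    1≤ε₁ : 1ℚ ℚ.≤ ε₁ f s k
    1≤ε₁ = ÷-mono-≤ 1 (numerator f s * (f * s * (f * s))) 1 (denominator f s * k) (≤-trans (≤-reflexive (*-identityˡ _))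
      (≤-trans (*-mono-≤ (denominator≤numerator f s) (≤-trans k≤x (m≤m*n (f * s) (f * s) {{>-nonZero (≤-trans 0<k k≤x)}})))
      (≤-reflexive (sym (*-identityʳ _)))))
  ... | no _ | no 2k²≰n = probLe-of-1≤ R (ℚ.≤-trans 1≤ε₂ (p≤q+r+p {ε₂ f s n k} {r} {ε₁ f s k} (ConstLt⇒0≤r {f} {s} c<rE) (0≤ε₁ f s k)))
    where
    instance _ = m*n≢0 (denominator f s) n {{>-nonZero (0<denominator f s)}} {{>-nonZero (≤-trans 0<k k≤n)}}
    1≤ε₂ : 1ℚ ℚ.≤ ε₂ f s n k
    1≤ε₂ = ÷-mono-≤ 1 (2 * numerator f s * (k * k)) 1 (denominator f s * n) (≤-trans (≤-reflexive (*-identityˡ _))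
      (≤-trans (*-mono-≤ (denominator≤numerator f s) (<⇒≤ (≰⇒> 2k²≰n)))
      (≤-reflexive (trans (solve 2 (λ S k → S :* (con 2 :* k :* k) := con 2 :* S :* (k :* k)) refl (numerator f s) k)
                          (sym (*-identityʳ _))))))
  ... | no k≰x | yes 2k²≤n = subst (λ k → ProbLe n k f s R (r ℚ.+ ε₁ f s k ℚ.+ ε₂ f s n k)) (m+[n∸m]≡n x≤k)
    (MainCase.probLe-main R disjoint 0<s (m<n⇒0<n∸m (≰⇒> k≰x)) (subst (λ k → 2 * k * k ≤ n) (sym (m+[n∸m]≡n x≤k)) 2k²≤n) r c<rE)
    where
    x≤k : f * s ≤ k
    x≤k = <⇒≤ (≰⇒> k≰x)

  ε₁-null : ∀ f s → NonnegNull₁ (ε₁ f s)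
  ε₁-null f s = 0≤ε₁ f s , a÷[c*n]→0 (numerator f s * (f * s * (f * s))) (denominator f s) (0<denominator f s)

  ε₂-null : ∀ f s → NonnegNull₂ (ε₂ f s)
  ε₂-null f s = 0≤ε₂ f s , λ k → a÷[c*n]→0 (2 * numerator f s * (k * k)) (denominator f s) (0<denominator f s)

open import Defs
open import Data.Nat using (ℕ; _≤_; _<_)
open import Data.Fin using (Fin)
open import Data.Fin.Subset using (Subset)
open import Data.Product using (∃-syntax; _×_; _,_)
open import Data.Rational using (ℚ; _+_)
open MainBound using (ε₁; ε₂; ε₁-null; ε₂-null; bound)

lemmaA3 : (f s : ℕ) → 0 < s →
    ∃[ ε₁ ] ∃[ ε₂ ] (NonnegNull₁ ε₁ × NonnegNull₂ ε₂ ×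
    (∀ (n k : ℕ) → 0 < k → k ≤ n →
    (R : Fin f → Subset n) → PairwiseDisjoint R →
    ∀ (r : ℚ) → ConstLt f s r →
    ProbLe n k f s R (r + ε₁ k + ε₂ n k)))
lemmaA3 f s 0<s = ε₁ f s , ε₂ f s , ε₁-null f s , ε₂-null f s , bound f s 0<s
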